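{- Let $j\ge1$ and let $p_1<p_2<\cdots<p_j$ be primes with $p_1=2$; put $m_j=p_1p_2\cdots p_j$. Let $I$ be an interval of $L$ consecutive integers, where $2^j\mid L$ and $L\ge4^j$. Then $I$ can be partitioned into $2^j$ sets $A_{v,j}$, indexed by the divisors $v$ of $m_j$, each of size $L/2^j$, such that every member of $A_{v,j}$ is coprime to $v$. Moreover, each $A_{v,j}$ is a $2^{j-1}$-AP combination whose constituent arithmetic progressions have common differences dividing $m_j$; consequently, for any integer $d$ coprime to $m_j$, the number of elements of $A_{v,j}$ divisible by $d$ is within $2^{j-1}$ of $|A_{v,j}|/d$.
   Context: Arithmetic progressions here are finite (possibly empty) sets of integers $\{a, a+q, \dots, a+(m-1)q\}$. For an integer $k\ge1$, a set $S$ of integers is a $k$-AP combination if it can be built by the following rules: (1) a single arithmetic progression is a $1$-AP combination; (2) if $S_1$ is a $k_1$-AP combination, $S_2$ is a $k_2$-AP combination and $S_1\cap S_2=\emptyset$, then $S_1\cup S_2$ is a $(k_1+k_2)$-AP combination; (3) if $S_1$ is a $k_1$-AP combination and $S_2\subseteq S_1$ is a $k_2$-AP combination, then $S_1\setminus S_2$ is a $(k_1+k_2)$-AP combination. The constituent arithmetic progressions of $S$ are those used in such a construction. -}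

module Defs where

open import Level using (Level; 0ℓ)
open import Data.Nat as ℕ using (ℕ; zero; suc; _^_)
open import Data.Nat.Properties using (m^n≢0)
open import Data.Nat.DivMod using (_/_)
open import Data.Integer as ℤ using (ℤ; +_)
open import Data.Integer.Divisibility as ℤd using ()
open import Data.Product using (_×_)
open import Data.Sum using (_⊎_)
open import Relation.Nullary using (¬_)
open import Function.Bundles using (_⇔_)

ISet : Set₁
ISet = ℤ → Set

InAP : (a q : ℤ) (m : ℕ) → ISet
InAP a q m x = Data.Product.Σ ℕ (λ i → (i ℕ.< m) × (x Relation.Binary.PropositionalEquality.≡ a ℤ.+ (+ i) ℤ.* q))
  where import Relation.Binary.PropositionalEquality

data APComb (Q : ℤ → Set) : ℕ → ISet → Set₁ where
  single : ∀ {S} (a q : ℤ) (m : ℕ) → Q q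
         → (∀ x → S x ⇔ InAP a q m x) → APComb Q 1 S
  union  : ∀ {k₁ k₂ S₁ S₂ S} → APComb Q k₁ S₁ → APComb Q k₂ S₂
         → (∀ x → ¬ (S₁ x × S₂ x))
         → (∀ x → S x ⇔ (S₁ x ⊎ S₂ x)) → APComb Q (k₁ ℕ.+ k₂) S
  diff   : ∀ {k₁ k₂ S₁ S₂ S} → APComb Q k₁ S₁ → APComb Q k₂ S₂
         → (∀ x → S₂ x → S₁ x)
         → (∀ x → S x ⇔ (S₁ x × ¬ S₂ x)) → APComb Q (k₁ ℕ.+ k₂) S

-- Product p 1 * p 2 * ... * p n   (primes indexed from 1).
primorial : (ℕ → ℕ) → ℕ → ℕ
primorial p zero    = 1
primorial p (suc n) = primorial p n ℕ.* p (suc n)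

divPow2 : ℕ → ℕ → ℕ
divPow2 L j = _/_ L (2 ^ j) {{m^n≢0 2 j}}

InInterval : ℤ → ℕ → ISet
InInterval a L x = (a ℤ.≤ x) × (x ℤ.< a ℤ.+ + L)

-- The partition is built by induction on j, starting from the even/odd split for m₁ = 2.
-- To pass from m_j to m_j p, each A_v, of size 2h, is split at a cutoff c: its elements below c that
-- are not divisible by p form A_{vp}, the others stay in A_v, and c is chosen by a discrete
-- intermediate value argument so that both parts have size h. Such a c exists because A_v has at
-- most h multiples of p: an AP whose difference is coprime to p meets a residue class mod p in an AP
-- with a p-th of its terms up to one, so a k-AP combination has |A_v|/p ± k multiples of p, and
-- 2h/p + k ≤ h since p ≥ 3 and 4k ≤ h (this is where L ≥ 4^j is used). Intersecting with [0, c),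
-- with [c, ∞) or with a residue class maps APs to APs, so both parts are 2k-AP combinations, and the
-- same count of multiples gives the final discrepancy bound.

module Submission where

open import Defs
open import Data.Nat using (ℕ; _≤_; _<_; _^_; _∸_; _*_)
open import Data.Nat.Divisibility using (_∣_; _∣?_)
open import Data.Nat.Primality using (Prime)
open import Data.Nat.Coprimality using (Coprime)
open import Data.Integer as ℤ using (ℤ; +_; ∣_∣)
open import Data.Integer.Divisibility as ℤd using ()
open import Data.List using (List; length; filter)
open import Data.List.Membership.Propositional using (_∈_)
open import Data.List.Relation.Unary.Unique.Propositional using (Unique)
open import Data.Product using (Σ; _×_; _,_)
open import Relation.Binary.PropositionalEquality using (_≡_)

open import Data.Bool using (Bool; true; false; _∧_; _∨_; not; T; if_then_else_)
open import Data.Bool.Properties using (T-∧; T-∨; T-≡; ∧-distribʳ-∨)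
open import Data.Empty using (⊥-elim)
open import Data.Integer.DivMod using (_%ℕ_; _/ℕ_; a≡a%ℕn+[a/ℕn]*n)
import Data.Integer.Divisibility.Signed as Sg
import Data.Integer.Properties as ℤP
open import Data.Integer.Tactic.RingSolver using () renaming (solve-∀ to ℤsolve-∀)
open import Data.List using ([]; _∷_; map; upTo)
open import Data.List.Properties using (length-map; length-upTo)
open import Data.List.Membership.Propositional.Properties
  using (∈-map⁺; ∈-map⁻; ∈-filter⁺; ∈-filter⁻; ∈-upTo⁺; ∈-upTo⁻)
open import Data.List.Membership.Propositional.Properties.WithK using (unique∧set⇒bag)
open import Data.List.Relation.Binary.BagAndSetEquality using (∼bag⇒↭)
open import Data.List.Relation.Binary.Permutation.Propositional.Properties using (↭-length)
import Data.List.Relation.Unary.All as All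
import Data.List.Relation.Unary.AllPairs as AllPairs
open import Data.List.Relation.Unary.Any using (here; there)
import Data.List.Relation.Unary.Unique.Propositional.Properties as Unique
open import Data.Nat as ℕ using (zero; suc; _+_; z≤n; s≤s)
open import Data.Nat.Coprimality using (coprime-Bézout; coprime-divisor; 1-coprimeTo)
import Data.Nat.Coprimality as Cop
open import Data.Nat.DivMod using (_%_; _/_; m≡m%n+[m/n]*n; m%n<n; m/n*n≡m; m*n/n≡m)
open import Data.Nat.Divisibility
  using ( divides; 1∣_; _∣0; ∣-refl; ∣-trans; ∣1⇒≡1; ∣⇒≤; ∣m+n∣m⇒∣n; ∣m∣n⇒∣m+n
        ; n∣m*n; ∣m⇒∣m*n; *-monoˡ-∣; *-cancelʳ-∣)
open import Data.Nat.GCD using (module Bézout)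
open import Data.Nat.Primality using (prime⇒irreducible; prime⇒nonTrivial; prime⇒nonZero; euclidsLemma)
import Data.Nat.Properties as ℕP
open import Data.Nat.Tactic.RingSolver using (solve-∀)
open import Data.Product using (proj₁; proj₂)
open import Data.Product.Function.NonDependent.Propositional using (_×-⇔_)
open import Data.Sum using (_⊎_; inj₁; inj₂)
open import Function using (_∘_; id)
open import Function.Bundles using (_⇔_; mk⇔; Equivalence)
import Function.Properties.Equivalence as ⇔
open import Function.Related.TypeIsomorphisms using (¬-cong-⇔)
open import Relation.Binary.PropositionalEquality
  using (refl; sym; trans; cong; cong₂; subst; subst₂; module ≡-Reasoning)
open import Relation.Nullary using (¬_; Dec; yes; no; does)
open import Relation.Nullary.Decidable using (T?)

open Equivalence using (to; from)
open import Algebra.Properties.CommutativeSemigroup ℕP.+-commutativeSemigroup using (interchange)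
open import Algebra.Properties.AbelianGroup ℤP.+-0-abelianGroup using (∙-cancelˡ; x≈z//y)

-- Counting Boolean predicates

𝟙 : Bool → ℕ
𝟙 true  = 1
𝟙 false = 0

T-does : ∀ {A : Set} (A? : Dec A) → T (does A?) ⇔ A
T-does (yes a) = mk⇔ (λ _ → a) (λ _ → _)
T-does (no ¬a) = mk⇔ (λ ()) ¬a

T-not : ∀ {b} → T (not b) ⇔ (¬ T b)
T-not {true}  = mk⇔ (λ ()) (λ ¬⊤ → ¬⊤ _)
T-not {false} = mk⇔ (λ _ ()) (λ _ → _)

count : (ℕ → Bool) → List ℕ → ℕ
count P xs = length (filter (T? ∘ P) xs)

count-∷ : ∀ P x xs → count P (x ∷ xs) ≡ 𝟙 (P x) + count P xs
count-∷ P x xs with P x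
... | true  = refl
... | false = refl

count-additive : ∀ {P Q R} → (∀ x → 𝟙 (P x) ≡ 𝟙 (Q x) + 𝟙 (R x))
               → ∀ xs → count P xs ≡ count Q xs + count R xs
count-additive h [] = refl
count-additive {P} {Q} {R} h (x ∷ xs) = begin
  count P (x ∷ xs)                                   ≡⟨ count-∷ P x xs ⟩
  𝟙 (P x) + count P xs                               ≡⟨ cong₂ _+_ (h x) (count-additive h xs) ⟩
  (𝟙 (Q x) + 𝟙 (R x)) + (count Q xs + count R xs)   ≡⟨ interchange (𝟙 (Q x)) _ _ _ ⟩
  (𝟙 (Q x) + count Q xs) + (𝟙 (R x) + count R xs)   ≡⟨ cong₂ _+_ (count-∷ Q x xs) (count-∷ R x xs) ⟨
  count Q (x ∷ xs) + count R (x ∷ xs)                ∎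
  where open ≡-Reasoning

private
  𝟙-≤-+ : ∀ x y z → (T x → T y ⊎ T z) → 𝟙 x ≤ 𝟙 y + 𝟙 z
  𝟙-≤-+ false _     _     _ = z≤n
  𝟙-≤-+ true  true  _     _ = s≤s z≤n
  𝟙-≤-+ true  false true  _ = s≤s z≤n
  𝟙-≤-+ true  false false x⇒y∨z with x⇒y∨z _
  ... | inj₁ ()
  ... | inj₂ ()

count-subadditive : ∀ {P Q R} → (∀ x → T (P x) → T (Q x) ⊎ T (R x))
                  → ∀ xs → count P xs ≤ count Q xs + count R xs
count-subadditive h [] = z≤n
count-subadditive {P} {Q} {R} h (x ∷ xs) = begin
  count P (x ∷ xs)                                   ≡⟨ count-∷ P x xs ⟩
  𝟙 (P x) + count P xs                               ≤⟨ ℕP.+-mono-≤ (𝟙-≤-+ (P x) (Q x) (R x) (h x))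
                                                                      (count-subadditive h xs) ⟩
  (𝟙 (Q x) + 𝟙 (R x)) + (count Q xs + count R xs)   ≡⟨ interchange (𝟙 (Q x)) _ _ _ ⟩
  (𝟙 (Q x) + count Q xs) + (𝟙 (R x) + count R xs)   ≡⟨ cong₂ _+_ (count-∷ Q x xs) (count-∷ R x xs) ⟨
  count Q (x ∷ xs) + count R (x ∷ xs)                ∎
  where open ℕP.≤-Reasoning

count-cong-∈ : ∀ {P Q} xs → (∀ {x} → x ∈ xs → P x ≡ Q x) → count P xs ≡ count Q xs
count-cong-∈ [] h = refl
count-cong-∈ {P} {Q} (x ∷ xs) h = begin
  count P (x ∷ xs)       ≡⟨ count-∷ P x xs ⟩
  𝟙 (P x) + count P xs   ≡⟨ cong₂ _+_ (cong 𝟙 (h (here refl))) (count-cong-∈ xs (h ∘ there)) ⟩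
  𝟙 (Q x) + count Q xs   ≡⟨ sym (count-∷ Q x xs) ⟩
  count Q (x ∷ xs)       ∎
  where open ≡-Reasoning

count-none : ∀ {P} xs → (∀ {x} → x ∈ xs → ¬ T (P x)) → count P xs ≡ 0
count-none [] h = refl
count-none {P} (x ∷ xs) h with P x | h (here refl)
... | true  | ¬⊤ = ⊥-elim (¬⊤ _)
... | false | _  = count-none xs (h ∘ there)

length-unique-≡ : ∀ {xs ys : List ℕ} → Unique xs → Unique ys → (∀ x → x ∈ xs ⇔ x ∈ ys)
                → length xs ≡ length ys
length-unique-≡ xs! ys! xs≈ys = ↭-length (∼bag⇒↭ (unique∧set⇒bag xs! ys! (λ {x} → xs≈ys x)))

count-≟-unique : ∀ s {xs} → Unique xs → count (λ i → does (i ℕ.≟ s)) xs ≤ 1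
count-≟-unique s {[]} AllPairs.[] = z≤n
count-≟-unique s {x ∷ xs} (x∉xs AllPairs.∷ xs!) =
  subst (_≤ 1) (sym (count-∷ (λ i → does (i ℕ.≟ s)) x xs)) (head-case (x ℕ.≟ s))
  where
  head-case : (x≟s : Dec (x ≡ s)) → 𝟙 (does x≟s) + count (λ i → does (i ℕ.≟ s)) xs ≤ 1
  head-case (yes refl) = s≤s (ℕP.≤-reflexive (count-none xs (λ y∈xs y≡x →
    All.lookup x∉xs y∈xs (sym (to (T-does (_ ℕ.≟ x)) y≡x)))))
  head-case (no _)     = count-≟-unique s xs!

infixr 7 _∩_
infixr 6 _∪_

_∩_ _∪_ : (ℕ → Bool) → (ℕ → Bool) → ℕ → Bool
(P ∩ Q) i = P i ∧ Q i
(P ∪ Q) i = P i ∨ Q i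

∁ : (ℕ → Bool) → ℕ → Bool
∁ P i = not (P i)

below : ℕ → ℕ → Bool
below c i = does (i ℕ.<? c)

private
  𝟙-∨ : ∀ x y → x ∧ y ≡ false → 𝟙 (x ∨ y) ≡ 𝟙 x + 𝟙 y
  𝟙-∨ true  true  ()
  𝟙-∨ true  false _ = refl
  𝟙-∨ false y     _ = refl

  𝟙-∖ : ∀ x y → (T y → T x) → 𝟙 x ≡ 𝟙 (x ∧ not y) + 𝟙 y
  𝟙-∖ true  true  _ = refl
  𝟙-∖ true  false _ = refl
  𝟙-∖ false true  y⇒x = ⊥-elim (y⇒x _)
  𝟙-∖ false false _ = refl

  𝟙-split : ∀ x y → 𝟙 x ≡ 𝟙 (x ∧ not y) + 𝟙 (x ∧ y)
  𝟙-split true  true  = refl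
  𝟙-split true  false = refl
  𝟙-split false y     = refl

count-∪ : ∀ {P Q S} → (∀ i → (P ∩ Q) i ≡ false) → (∀ i → S i ≡ (P ∪ Q) i)
        → ∀ xs → count S xs ≡ count P xs + count Q xs
count-∪ {P} {Q} P∩Q≡∅ S≡P∪Q =
  count-additive (λ i → trans (cong 𝟙 (S≡P∪Q i)) (𝟙-∨ (P i) (Q i) (P∩Q≡∅ i)))

count-∖ : ∀ {P Q S} → (∀ i → T (Q i) → T (P i)) → (∀ i → S i ≡ (P ∩ ∁ Q) i)
        → ∀ xs → count P xs ≡ count S xs + count Q xs
count-∖ {P} {Q} Q⊆P S≡P∖Q =
  count-additive (λ i → trans (𝟙-∖ (P i) (Q i) (Q⊆P i)) (cong (λ b → 𝟙 b + 𝟙 (Q i)) (sym (S≡P∖Q i))))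

count-split : ∀ P Q xs → count P xs ≡ count (P ∩ ∁ Q) xs + count (P ∩ Q) xs
count-split P Q = count-additive (λ i → 𝟙-split (P i) (Q i))

-- Arithmetic on ℕ

initial-segment : ∀ {Q : ℕ → Set} → (∀ t → Dec (Q t)) → (∀ {s t} → s ≤ t → Q t → Q s)
                → ∀ n → Σ ℕ λ n′ → n′ ≤ n × (∀ {t} → t < n → Q t ⇔ t < n′)
initial-segment Q? down zero = 0 , z≤n , λ ()
initial-segment {Q} Q? down (suc n) with initial-segment Q? down n
... | n′ , n′≤n , seg with n′ ℕP.≟ n | Q? n
...   | yes refl | yes Qn = suc n , ℕP.≤-refl , λ t<1+n →
          mk⇔ (λ _ → t<1+n) (λ _ → down (ℕP.m<1+n⇒m≤n t<1+n) Qn)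
...   | yes refl | no ¬Qn = n , ℕP.n≤1+n n , λ t<1+n →
          mk⇔ (λ Qt → ℕP.≤∧≢⇒< (ℕP.m<1+n⇒m≤n t<1+n) (λ { refl → ¬Qn Qt }))
              (λ t<n → from (seg t<n) t<n)
...   | no n′≢n | _ = n′ , ℕP.m≤n⇒m≤1+n n′≤n , λ t<1+n →
          mk⇔ (λ Qt → ℕP.≰⇒> (λ n′≤t → ℕP.<-irrefl refl (to (seg n′<n) (down n′≤t Qt))))
              (λ t<n′ → from (seg (ℕP.<-≤-trans t<n′ n′≤n)) t<n′)
  where
  n′<n : n′ < n
  n′<n = ℕP.≤∧≢⇒< n′≤n n′≢n

crossing : (ℕ → ℕ) → ℕ → ℕ → ℕ
crossing g h zero    = 0
crossing g h (suc N) with h ℕ.≤? g N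
... | yes _ = crossing g h N
... | no  _ = suc N

crossing-correct : ∀ (g : ℕ → ℕ) h N → g 0 ≡ 0 → (∀ s → g (suc s) ≤ suc (g s)) → h ≤ g N
                 → g (crossing g h N) ≡ h
crossing-correct g h zero    g0≡0 _ h≤g0 = trans g0≡0 (sym (ℕP.n≤0⇒n≡0 (subst (h ≤_) g0≡0 h≤g0)))
crossing-correct g h (suc N) g0≡0 step h≤gN+1 with h ℕ.≤? g N
... | yes h≤gN = crossing-correct g h N g0≡0 step h≤gN
... | no  h≰gN = ℕP.≤-antisym (ℕP.≤-trans (step N) (ℕP.≰⇒> h≰gN)) h≤gN+1

≤-from-scaled : ∀ c h k d → 3 ≤ d → 4 * k ≤ h → c * d ≤ (h + h) + k * d → c ≤ h
≤-from-scaled c h k d@(suc _) 3≤d 4k≤h cd≤ = ℕP.*-cancelʳ-≤ c h d (ℕP.*-cancelˡ-≤ 4 (begin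
  4 * (c * d)                ≤⟨ ℕP.*-monoʳ-≤ 4 cd≤ ⟩
  4 * ((h + h) + k * d)      ≡⟨ expand h k d ⟩
  8 * h + (4 * k) * d        ≤⟨ ℕP.+-monoʳ-≤ (8 * h) (ℕP.*-monoˡ-≤ d 4k≤h) ⟩
  8 * h + h * d              ≤⟨ ℕP.+-monoˡ-≤ (h * d) (ℕP.*-monoˡ-≤ h 8≤3d) ⟩
  (3 * d) * h + h * d        ≡⟨ collect h d ⟩
  4 * (h * d)                ∎))
  where
  open ℕP.≤-Reasoning
  8≤3d : 8 ≤ 3 * d
  8≤3d = ℕP.≤-trans (ℕP.n≤1+n 8) (ℕP.*-monoʳ-≤ 3 3≤d)
  expand : ∀ h k d → 4 * ((h + h) + k * d) ≡ 8 * h + (4 * k) * d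
  expand = solve-∀
  collect : ∀ h d → (3 * d) * h + h * d ≡ 4 * (h * d)
  collect = solve-∀

∣m-n∣≤k : ∀ {m n k} → m ≤ n + k → n ≤ m + k → ∣ + m ℤ.- + n ∣ ≤ k
∣m-n∣≤k {m} {n} m≤n+k n≤m+k rewrite ℤP.m-n≡m⊖n m n with ℕP.≤-total m n
... | inj₁ m≤n rewrite ℤP.∣⊖∣-≤ m≤n = ℕP.m≤n+o⇒m∸n≤o n m n≤m+k
... | inj₂ n≤m rewrite ℤP.∣m⊖n∣≡∣n⊖m∣ m n | ℤP.∣⊖∣-≤ n≤m = ℕP.m≤n+o⇒m∸n≤o m n m≤n+k

∣m-n∣≤k⇒m≤n+k : ∀ {m n k} → ∣ + m ℤ.- + n ∣ ≤ k → m ≤ n + k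
∣m-n∣≤k⇒m≤n+k {m} {n} {k} ∣m-n∣≤k = begin
  m                              ≡⟨ cong ∣_∣ (ℤ-split (+ m) (+ n)) ⟩
  ∣ (+ m ℤ.- + n) ℤ.+ + n ∣     ≤⟨ ℤP.∣i+j∣≤∣i∣+∣j∣ (+ m ℤ.- + n) (+ n) ⟩
  ∣ + m ℤ.- + n ∣ + n            ≤⟨ ℕP.+-monoˡ-≤ n ∣m-n∣≤k ⟩
  k + n                          ≡⟨ ℕP.+-comm k n ⟩
  n + k                          ∎
  where
  open ℕP.≤-Reasoning
  ℤ-split : ∀ i j → i ≡ (i ℤ.- j) ℤ.+ j
  ℤ-split = ℤsolve-∀

4^n≡2^n*2^n : ∀ n → 4 ^ n ≡ 2 ^ n * 2 ^ n
4^n≡2^n*2^n zero    = refl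
4^n≡2^n*2^n (suc n) = trans (cong (4 *_) (4^n≡2^n*2^n n)) (regroup (2 ^ n))
  where
  regroup : ∀ x → 4 * (x * x) ≡ (2 * x) * (2 * x)
  regroup = solve-∀

4*2^[n∸1]≡2^[1+n] : ∀ n → 1 ≤ n → 4 * 2 ^ (n ∸ 1) ≡ 2 ^ suc n
4*2^[n∸1]≡2^[1+n] (suc n) _ = assoc (2 ^ n)
  where
  assoc : ∀ x → 4 * x ≡ 2 * (2 * x)
  assoc = solve-∀

2^[n∸1]+2^[n∸1]≡2^n : ∀ n → 1 ≤ n → 2 ^ (n ∸ 1) + 2 ^ (n ∸ 1) ≡ 2 ^ n
2^[n∸1]+2^[n∸1]≡2^n (suc n) _ = cong (_+_ (2 ^ n)) (sym (ℕP.+-identityʳ (2 ^ n)))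

-- Arithmetic progressions of natural numbers

InAPℕ : ℕ → ℕ → ℕ → ℕ → Set
InAPℕ m q n i = Σ ℕ λ t → t < n × i ≡ m + t * q

apList : ℕ → ℕ → ℕ → List ℕ
apList m q n = map (λ t → m + t * q) (upTo n)

∈-apList : ∀ {m q n i} → i ∈ apList m q n ⇔ InAPℕ m q n i
∈-apList {m} {q} {n} = mk⇔
  (λ i∈ → let t , t∈ , i≡ = ∈-map⁻ (λ t → m + t * q) i∈ in t , ∈-upTo⁻ t∈ , i≡)
  (λ { (t , t<n , refl) → ∈-map⁺ (λ t → m + t * q) (∈-upTo⁺ t<n) })

apList-unique : ∀ m {q} n → 1 ≤ q → Unique (apList m q n)
apList-unique m {suc q} n _ = Unique.map⁺ injective (Unique.upTo⁺ n)
  where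
  injective : ∀ {s t} → m + s * suc q ≡ m + t * suc q → s ≡ t
  injective {s} {t} eq = ℕP.*-cancelʳ-≡ s t (suc q) (ℕP.+-cancelˡ-≡ m _ _ eq)

count-AP : ∀ {P m q n} L → 1 ≤ q → (∀ i → T (P i) ⇔ InAPℕ m q n i) → (∀ i → T (P i) → i < L)
         → count P (upTo L) ≡ n
count-AP {P} {m} {q} {n} L 1≤q P≈AP P<L = begin
  count P (upTo L)        ≡⟨ length-unique-≡ (Unique.filter⁺ (T? ∘ P) (Unique.upTo⁺ L)) (apList-unique m n 1≤q)
                                              same ⟩
  length (apList m q n)   ≡⟨ length-map _ (upTo n) ⟩
  length (upTo n)         ≡⟨ length-upTo n ⟩
  n                       ∎
  where
  open ≡-Reasoning
  same : ∀ i → i ∈ filter (T? ∘ P) (upTo L) ⇔ i ∈ apList m q n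
  same i = mk⇔
    (λ i∈ → from ∈-apList (to (P≈AP i) (proj₂ (∈-filter⁻ (T? ∘ P) {xs = upTo L} i∈))))
    (λ i∈ → let Pi = from (P≈AP i) (to ∈-apList i∈)
            in ∈-filter⁺ (T? ∘ P) (∈-upTo⁺ (P<L i Pi)) Pi)

private
  AP-prefix : ∀ m q n c → Σ ℕ λ n′ → n′ ≤ n × (∀ {t} → t < n → m + t * q < c ⇔ t < n′)
  AP-prefix m q n c = initial-segment (λ t → m + t * q ℕ.<? c)
    (λ s≤t → ℕP.≤-<-trans (ℕP.+-monoʳ-≤ m (ℕP.*-monoˡ-≤ q s≤t))) n

AP-∩-< : ∀ m q n c → Σ ℕ λ n′ → ∀ i → (InAPℕ m q n i × i < c) ⇔ InAPℕ m q n′ i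
AP-∩-< m q n c with AP-prefix m q n c
... | n′ , n′≤n , prefix = n′ , λ i → mk⇔
  (λ { ((t , t<n , refl) , i<c) → t , to (prefix t<n) i<c , refl })
  (λ { (t , t<n′ , refl) → let t<n = ℕP.<-≤-trans t<n′ n′≤n
                           in (t , t<n , refl) , from (prefix t<n) t<n′ })

AP-∩-≥ : ∀ m q n c → Σ ℕ λ m′ → Σ ℕ λ n′
       → ∀ i → (InAPℕ m q n i × ¬ i < c) ⇔ InAPℕ m′ q n′ i
AP-∩-≥ m q n c with AP-prefix m q n c
... | n′ , n′≤n , prefix = m + n′ * q , n ∸ n′ , λ i → mk⇔ into back
  where
  shift : ∀ s → m + (n′ + s) * q ≡ m + n′ * q + s * q
  shift s = trans (cong (_+_ m) (ℕP.*-distribʳ-+ q n′ s)) (sym (ℕP.+-assoc m _ _))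
  into : ∀ {i} → InAPℕ m q n i × ¬ i < c → InAPℕ (m + n′ * q) q (n ∸ n′) i
  into ((t , t<n , refl) , ¬i<c) = t ∸ n′ , ℕP.∸-monoˡ-< t<n n′≤t ,
    trans (cong (λ u → m + u * q) (sym (ℕP.m+[n∸m]≡n n′≤t))) (shift (t ∸ n′))
    where
    n′≤t : n′ ≤ t
    n′≤t = ℕP.≮⇒≥ (λ t<n′ → ¬i<c (from (prefix t<n) t<n′))
  back : ∀ {i} → InAPℕ (m + n′ * q) q (n ∸ n′) i → InAPℕ m q n i × ¬ i < c
  back (s , s<n-n′ , refl) = (n′ + s , t<n , sym (shift s)) ,
    λ i<c → ℕP.<⇒≱ (to (prefix t<n) (subst (_< c) (sym (shift s)) i<c)) (ℕP.m≤m+n n′ s)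
    where
    t<n : n′ + s < n
    t<n = subst (n′ + s <_) (ℕP.m+[n∸m]≡n n′≤n) (ℕP.+-monoʳ-< n′ s<n-n′)

private
  bézout-solution : ∀ {d q} → Coprime (suc d) q → ∀ R → Σ ℕ λ t → suc d ∣ R + t * q
  bézout-solution {d} {q} c R with coprime-Bézout c
  ... | Bézout.+- x y 1+yq≡xd = R * y , divides (R * x) (begin
    R + R * y * q      ≡⟨ factor R y q ⟩
    R * (1 + y * q)    ≡⟨ cong (R *_) 1+yq≡xd ⟩
    R * (x * suc d)    ≡⟨ ℕP.*-assoc R x (suc d) ⟨
    R * x * suc d      ∎)
    where
    open ≡-Reasoning
    factor : ∀ R y q → R + R * y * q ≡ R * (1 + y * q)
    factor = solve-∀
  ... | Bézout.-+ x y 1+xd≡yq = R * d * y , divides (R + R * d * x) (begin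
    R + R * d * y * q            ≡⟨ cong (_+_ R) (ℕP.*-assoc (R * d) y q) ⟩
    R + R * d * (y * q)          ≡⟨ cong (λ u → R + R * d * u) 1+xd≡yq ⟨
    R + R * d * (1 + x * suc d)  ≡⟨ factor R d x ⟩
    (R + R * d * x) * suc d      ∎)
    where
    open ≡-Reasoning
    factor : ∀ R d x → R + R * d * (1 + x * suc d) ≡ (R + R * d * x) * suc d
    factor = solve-∀

linear-congruence : ∀ {d q} .{{_ : ℕ.NonZero d}} → Coprime d q
                  → ∀ R → Σ ℕ λ i₀ → i₀ < d × d ∣ R + i₀ * q
linear-congruence {d@(suc _)} {q} c R with bézout-solution c R
... | t , d∣R+tq = t % d , m%n<n t d , ∣m+n∣m⇒∣n (subst (d ∣_) reduce d∣R+tq) (n∣m*n (t / d * q))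
  where
  regroup : ∀ R i k q d → R + (i + k * d) * q ≡ k * q * d + (R + i * q)
  regroup = solve-∀
  reduce : R + t * q ≡ t / d * q * d + (R + t % d * q)
  reduce = trans (cong (λ u → R + u * q) (m≡m%n+[m/n]*n t d)) (regroup R (t % d) (t / d) q d)

private
  coprime-∣-shift : ∀ {d q} R u e → Coprime d q → d ∣ R + u * q → d ∣ R + (u + e) * q → d ∣ e
  coprime-∣-shift {d} {q} R u e c d∣R+uq d∣R+[u+e]q =
    coprime-divisor c (subst (d ∣_) (ℕP.*-comm e q)
      (∣m+n∣m⇒∣n (subst (d ∣_) (regroup R u e q) d∣R+[u+e]q) d∣R+uq))
    where
    regroup : ∀ R u e q → R + (u + e) * q ≡ (R + u * q) + e * q
    regroup = solve-∀

congruence-class : ∀ {d q} R i₀ t → Coprime d q → i₀ < d → d ∣ R + i₀ * q → d ∣ R + t * q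
                 → Σ ℕ λ s → t ≡ i₀ + s * d
congruence-class {d} {q} R i₀ t c i₀<d d∣i₀ d∣t with i₀ ℕP.≤? t
... | yes i₀≤t
  with coprime-∣-shift R i₀ (t ∸ i₀) c d∣i₀
         (subst (λ u → d ∣ R + u * q) (sym (ℕP.m+[n∸m]≡n i₀≤t)) d∣t)
...   | divides s t-i₀≡sd = s , trans (sym (ℕP.m+[n∸m]≡n i₀≤t)) (cong (_+_ i₀) t-i₀≡sd)
congruence-class {d} {q} R i₀ t c i₀<d d∣i₀ d∣t | no i₀≰t =
  ⊥-elim (ℕP.<-irrefl refl (ℕP.<-≤-trans (ℕP.≤-<-trans (ℕP.m∸n≤m i₀ t) i₀<d) d≤i₀-t))
  where
  t<i₀ : t < i₀
  t<i₀ = ℕP.≰⇒> i₀≰t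
  d∣i₀-t : d ∣ i₀ ∸ t
  d∣i₀-t = coprime-∣-shift R t (i₀ ∸ t) c d∣t
    (subst (λ u → d ∣ R + u * q) (sym (ℕP.m+[n∸m]≡n (ℕP.<⇒≤ t<i₀))) d∣i₀)
  d≤i₀-t : d ≤ i₀ ∸ t
  d≤i₀-t = ∣⇒≤ {{ℕ.>-nonZero (ℕP.m<n⇒0<n∸m t<i₀)}} d∣i₀-t

terms-below : ∀ i₀ d n → 1 ≤ d → Σ ℕ λ n′ → ∀ s → s < n′ ⇔ i₀ + s * d < n
terms-below i₀ d n 1≤d with AP-prefix i₀ d n n
... | n′ , n′≤n , prefix = n′ , λ s → by-cases s (s ℕ.<? n)
  where
  by-cases : ∀ s → Dec (s < n) → s < n′ ⇔ i₀ + s * d < n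
  by-cases s (yes s<n) = mk⇔ (from (prefix s<n)) (to (prefix s<n))
  by-cases s (no s≮n)  = mk⇔
    (λ s<n′ → ⊥-elim (s≮n (ℕP.<-≤-trans s<n′ n′≤n)))
    (λ lt → ⊥-elim (s≮n (ℕP.≤-<-trans s≤i₀+sd lt)))
    where
    s≤i₀+sd : s ≤ i₀ + s * d
    s≤i₀+sd = ℕP.≤-trans (ℕP.m≤m*n s d {{ℕ.>-nonZero 1≤d}}) (ℕP.m≤n+m (s * d) i₀)

AP-∩-residue : ∀ {d q} .{{_ : ℕ.NonZero d}} → Coprime d q → ∀ R m n →
  Σ ℕ λ i₀ → i₀ < d × Σ ℕ λ n′ → (∀ s → s < n′ ⇔ i₀ + s * d < n)
    × (∀ i → (InAPℕ m q n i × d ∣ R + i) ⇔ InAPℕ (m + i₀ * q) (d * q) n′ i)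
AP-∩-residue {d} {q} c R m n with linear-congruence c (R + m)
... | i₀ , i₀<d , d∣i₀ with terms-below i₀ d n (ℕ.>-nonZero⁻¹ d)
...   | n′ , below = i₀ , i₀<d , n′ , below , λ i → mk⇔ into back
  where
  term : ∀ m i₀ s d q → m + (i₀ + s * d) * q ≡ m + i₀ * q + s * (d * q)
  term = solve-∀
  shift : ∀ R m i₀ s q d → R + m + i₀ * q + s * q * d ≡ R + (m + i₀ * q + s * (d * q))
  shift = solve-∀
  into : ∀ {i} → InAPℕ m q n i × d ∣ R + i → InAPℕ (m + i₀ * q) (d * q) n′ i
  into ((t , t<n , refl) , d∣R+i)
    with congruence-class (R + m) i₀ t c i₀<d d∣i₀ (subst (d ∣_) (sym (ℕP.+-assoc R m (t * q))) d∣R+i)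
  ... | s , refl = s , from (below s) t<n , term m i₀ s d q
  back : ∀ {i} → InAPℕ (m + i₀ * q) (d * q) n′ i → InAPℕ m q n i × d ∣ R + i
  back (s , s<n′ , refl) = (i₀ + s * d , to (below s) s<n′ , sym (term m i₀ s d q)) ,
    subst (d ∣_) (shift R m i₀ s q d) (∣m∣n⇒∣m+n d∣i₀ (n∣m*n (s * q)))

residue-count-error : ∀ i₀ d n n′ → i₀ < d → (∀ s → s < n′ ⇔ i₀ + s * d < n)
                    → ∣ + n′ ℤ.* + d ℤ.- + n ∣ ≤ d
residue-count-error i₀ d n n′ i₀<d below =
  subst (λ x → ∣ x ℤ.- + n ∣ ≤ d) (ℤP.pos-* n′ d) (∣m-n∣≤k (upper n′ below) lower)
  where
  upper : ∀ c → (∀ s → s < c ⇔ i₀ + s * d < n) → c * d ≤ n + d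
  upper zero    _      = z≤n
  upper (suc s) below′ = subst (_≤ n + d) (ℕP.+-comm (s * d) d)
    (ℕP.+-monoˡ-≤ d (ℕP.<⇒≤ (ℕP.≤-<-trans (ℕP.m≤n+m (s * d) i₀) (to (below′ s) ℕP.≤-refl))))
  lower : n ≤ n′ * d + d
  lower = ℕP.≤-trans (ℕP.≮⇒≥ (λ lt → ℕP.<-irrefl refl (from (below n′) lt)))
    (subst (i₀ + n′ * d ≤_) (ℕP.+-comm d (n′ * d)) (ℕP.+-monoˡ-≤ (n′ * d) (ℕP.<⇒≤ i₀<d)))

-- AP combinations of indices

RestrictsToAP : ℕ → ℕ → (ℕ → Bool) → Set
RestrictsToAP M M′ R = ∀ m q n → 1 ≤ q → q ∣ M → Σ ℕ λ m′ → Σ ℕ λ q′ → Σ ℕ λ n′ →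
  1 ≤ q′ × q′ ∣ M′ × (∀ i → (InAPℕ m q n i × T (R i)) ⇔ InAPℕ m′ q′ n′ i)

private
  ∩-disjoint : ∀ {P Q} R → (∀ i → (P ∩ Q) i ≡ false) → ∀ i → ((P ∩ R) ∩ (Q ∩ R)) i ≡ false
  ∩-disjoint {P} {Q} R P∩Q≡∅ i with P i | Q i | R i | P∩Q≡∅ i
  ... | true  | true  | _     | ()
  ... | true  | false | true  | _ = refl
  ... | true  | false | false | _ = refl
  ... | false | _     | _     | _ = refl

  ∩-distribʳ-∪ : ∀ {P Q S} R → (∀ i → S i ≡ (P ∪ Q) i)
               → ∀ i → (S ∩ R) i ≡ ((P ∩ R) ∪ (Q ∩ R)) i
  ∩-distribʳ-∪ {P} {Q} R S≡P∪Q i = trans (cong (_∧ R i) (S≡P∪Q i)) (∧-distribʳ-∨ (R i) (P i) (Q i))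

  ∩-distribʳ-∖ : ∀ {P Q S} R → (∀ i → S i ≡ (P ∩ ∁ Q) i)
               → ∀ i → (S ∩ R) i ≡ ((P ∩ R) ∩ ∁ (Q ∩ R)) i
  ∩-distribʳ-∖ {P} {Q} R S≡P∖Q i = trans (cong (_∧ R i) (S≡P∖Q i)) (lemma (P i) (Q i) (R i))
    where
    lemma : ∀ x y r → (x ∧ not y) ∧ r ≡ (x ∧ r) ∧ not (y ∧ r)
    lemma true  true  true  = refl
    lemma true  true  false = refl
    lemma true  false true  = refl
    lemma true  false false = refl
    lemma false _     _     = refl

  ∩-monoˡ-⊆ : ∀ {P Q} R → (∀ i → T (Q i) → T (P i)) → ∀ i → T ((Q ∩ R) i) → T ((P ∩ R) i)
  ∩-monoˡ-⊆ {P} {Q} R Q⊆P i Qi∧Ri = let Qi , Ri = to (T-∧ {Q i}) Qi∧Ri in from T-∧ (Q⊆P i Qi , Ri)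

below-restricts : ∀ {M M′} c → (∀ {q} → q ∣ M → q ∣ M′) → RestrictsToAP M M′ (below c)
below-restricts c M⇒M′ m q n 1≤q q∣M with AP-∩-< m q n c
... | n′ , AP∩<≈AP′ = m , q , n′ , 1≤q , M⇒M′ q∣M ,
  λ i → ⇔.trans (⇔.refl ×-⇔ T-does (i ℕ.<? c)) (AP∩<≈AP′ i)

above-restricts : ∀ {M M′} c → (∀ {q} → q ∣ M → q ∣ M′) → RestrictsToAP M M′ (∁ (below c))
above-restricts c M⇒M′ m q n 1≤q q∣M with AP-∩-≥ m q n c
... | m′ , n′ , AP∩≥≈AP′ = m′ , q , n′ , 1≤q , M⇒M′ q∣M ,
  λ i → ⇔.trans (⇔.refl ×-⇔ ⇔.trans T-not (¬-cong-⇔ (T-does (i ℕ.<? c)))) (AP∩≥≈AP′ i)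

residue-restricts : ∀ {M M′ d D} R .{{_ : ℕ.NonZero d}} → (∀ {q} → q ∣ M → Coprime d q)
                  → (∀ {q} → q ∣ M → d * q ∣ M′) → (∀ i → T (D i) ⇔ d ∣ R + i)
                  → RestrictsToAP M M′ D
residue-restricts {d = d} R coprime dM⇒M′ D≈ m q n 1≤q q∣M with AP-∩-residue (coprime q∣M) R m n
... | i₀ , _ , n′ , _ , AP∩D≈AP′ =
  m + i₀ * q , d * q , n′ , ℕP.*-mono-≤ (ℕ.>-nonZero⁻¹ d) 1≤q , dM⇒M′ q∣M ,
  λ i → ⇔.trans (⇔.refl ×-⇔ D≈ i) (AP∩D≈AP′ i)

-- For D the multiples of the next prime p, Cut D S c (the non-multiples of p in S below the cutoff c)
-- becomes A_{vp}, and Rest D S c is what remains of A_v = S.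
Cut Rest : (ℕ → Bool) → (ℕ → Bool) → ℕ → ℕ → Bool
Cut  D S c = S ∩ (below c ∩ ∁ D)
Rest D S c = S ∩ ∁ (below c ∩ ∁ D)

Shifted : ℤ → (ℕ → Bool) → ISet
Shifted a P x = Σ ℕ λ i → T (P i) × x ≡ a ℤ.+ + i

+-injectiveʳ : ∀ a {i j} → a ℤ.+ + i ≡ a ℤ.+ + j → i ≡ j
+-injectiveʳ a eq = ℤP.+-injective (∙-cancelˡ a _ _ eq)

Shifted-AP : ∀ a {S m q n x} → (∀ i → T (S i) ⇔ InAPℕ m q n i) → Shifted a S x ⇔ InAP (a ℤ.+ + m) (+ q) n x
Shifted-AP a {S} {m} {q} {n} S≈AP = mk⇔ into back
  where
  term : ∀ t → a ℤ.+ + (m + t * q) ≡ (a ℤ.+ + m) ℤ.+ + t ℤ.* + q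
  term t = trans (cong (ℤ._+_ a) (trans (ℤP.pos-+ m (t * q)) (cong (ℤ._+_ (+ m)) (ℤP.pos-* t q))))
                 (sym (ℤP.+-assoc a (+ m) _))
  into : ∀ {x} → Shifted a S x → InAP (a ℤ.+ + m) (+ q) n x
  into (i , Si , refl) with to (S≈AP i) Si
  ... | t , t<n , refl = t , t<n , term t
  back : ∀ {x} → InAP (a ℤ.+ + m) (+ q) n x → Shifted a S x
  back (t , t<n , refl) = m + t * q , from (S≈AP _) (t , t<n , refl) , sym (term t)

Shifted-∪ : ∀ a {P Q S x} → (∀ i → S i ≡ (P ∪ Q) i) → Shifted a S x ⇔ (Shifted a P x ⊎ Shifted a Q x)
Shifted-∪ a {P} {Q} {S} S≡P∪Q = mk⇔ into back
  where
  into : ∀ {x} → Shifted a S x → Shifted a P x ⊎ Shifted a Q x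
  into (i , Si , x≡) with to (T-∨ {P i}) (subst T (S≡P∪Q i) Si)
  ... | inj₁ Pi = inj₁ (i , Pi , x≡)
  ... | inj₂ Qi = inj₂ (i , Qi , x≡)
  back : ∀ {x} → Shifted a P x ⊎ Shifted a Q x → Shifted a S x
  back (inj₁ (i , Pi , x≡)) = i , subst T (sym (S≡P∪Q i)) (from (T-∨ {P i}) (inj₁ Pi)) , x≡
  back (inj₂ (i , Qi , x≡)) = i , subst T (sym (S≡P∪Q i)) (from (T-∨ {P i}) (inj₂ Qi)) , x≡

Shifted-∖ : ∀ a {P Q S x} → (∀ i → S i ≡ (P ∩ ∁ Q) i) → Shifted a S x ⇔ (Shifted a P x × ¬ Shifted a Q x)
Shifted-∖ a {P} {Q} {S} S≡P∖Q = mk⇔ into back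
  where
  into : ∀ {x} → Shifted a S x → Shifted a P x × ¬ Shifted a Q x
  into (i , Si , x≡) with to (T-∧ {P i}) (subst T (S≡P∖Q i) Si)
  ... | Pi , ¬Qi = (i , Pi , x≡) , λ { (j , Qj , x≡′) →
    to T-not ¬Qi (subst (T ∘ Q) (+-injectiveʳ a (trans (sym x≡′) x≡)) Qj) }
  back : ∀ {x} → Shifted a P x × ¬ Shifted a Q x → Shifted a S x
  back ((i , Pi , x≡) , ¬Q) =
    i , subst T (sym (S≡P∖Q i)) (from T-∧ (Pi , from T-not (λ Qi → ¬Q (i , Qi , x≡)))) , x≡

Shifted-disjoint : ∀ a {P Q x} → (∀ i → (P ∩ Q) i ≡ false) → ¬ (Shifted a P x × Shifted a Q x)
Shifted-disjoint a {P} {Q} P∩Q≡∅ ((i , Pi , refl) , (j , Qj , a+i≡a+j)) with refl ← +-injectiveʳ a a+i≡a+j =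
  subst T (P∩Q≡∅ i) (from T-∧ (Pi , Qj))

Shifted-mono : ∀ a {P Q x} → (∀ i → T (Q i) → T (P i)) → Shifted a Q x → Shifted a P x
Shifted-mono a Q⊆P (i , Qi , x≡) = i , Q⊆P i Qi , x≡

listing : ℤ → ℕ → (ℕ → Bool) → List ℤ
listing a L P = map (λ i → a ℤ.+ + i) (filter (T? ∘ P) (upTo L))

listing-unique : ∀ a L P → Unique (listing a L P)
listing-unique a L P = Unique.map⁺ (+-injectiveʳ a) (Unique.filter⁺ (T? ∘ P) (Unique.upTo⁺ L))

∈-listing : ∀ {a L P x} → x ∈ listing a L P ⇔ (Σ ℕ λ i → i < L × T (P i) × x ≡ a ℤ.+ + i)
∈-listing {a} {L} {P} = mk⇔
  (λ x∈ → let i , i∈ , x≡ = ∈-map⁻ (λ i → a ℤ.+ + i) x∈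
              i∈L , Pi = ∈-filter⁻ (T? ∘ P) {xs = upTo L} i∈
          in i , ∈-upTo⁻ i∈L , Pi , x≡)
  (λ { (i , i<L , Pi , refl) → ∈-map⁺ (λ i → a ℤ.+ + i) (∈-filter⁺ (T? ∘ P) (∈-upTo⁺ i<L) Pi) })

length-listing : ∀ a L P → length (listing a L P) ≡ count P (upTo L)
length-listing a L P = length-map (λ i → a ℤ.+ + i) (filter (T? ∘ P) (upTo L))

length-filter-listing : ∀ {Q : ℤ → Set} (Q? : ∀ x → Dec (Q x)) a L P
                      → length (filter Q? (listing a L P))
                      ≡ count (P ∩ (λ i → does (Q? (a ℤ.+ + i)))) (upTo L)
length-filter-listing Q? a L P = go (upTo L)
  where
  go : ∀ xs → length (filter Q? (map (λ i → a ℤ.+ + i) (filter (T? ∘ P) xs)))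
            ≡ count (P ∩ (λ i → does (Q? (a ℤ.+ + i)))) xs
  go [] = refl
  go (x ∷ xs) rewrite count-∷ (P ∩ (λ i → does (Q? (a ℤ.+ + i)))) x xs with P x
  ... | false = go xs
  ... | true with Q? (a ℤ.+ + x)
  ...   | yes _ = cong suc (go xs)
  ...   | no  _ = go xs

interval-index : ∀ {a L x} → InInterval a L x → Σ ℕ λ i → i < L × x ≡ a ℤ.+ + i
interval-index {a} {L} {x} (a≤x , x<a+L) = ∣ x ℤ.- a ∣ , ℤP.drop‿+<+ ∣x-a∣<L , x≡a+∣x-a∣
  where
  +∣x-a∣≡x-a : + ∣ x ℤ.- a ∣ ≡ x ℤ.- a
  +∣x-a∣≡x-a = ℤP.0≤i⇒+∣i∣≡i (ℤP.i≤j⇒0≤j-i a≤x)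
  x≡a+[x-a] : ∀ x a → x ≡ a ℤ.+ (x ℤ.- a)
  x≡a+[x-a] = ℤsolve-∀
  [a+L]-a≡L : ∀ a L → a ℤ.+ L ℤ.- a ≡ L
  [a+L]-a≡L = ℤsolve-∀
  x≡a+∣x-a∣ : x ≡ a ℤ.+ + ∣ x ℤ.- a ∣
  x≡a+∣x-a∣ = trans (x≡a+[x-a] x a) (cong (ℤ._+_ a) (sym +∣x-a∣≡x-a))
  ∣x-a∣<L : + ∣ x ℤ.- a ∣ ℤ.< + L
  ∣x-a∣<L = subst₂ ℤ._<_ (sym +∣x-a∣≡x-a) ([a+L]-a≡L a (+ L)) (ℤP.+-monoˡ-< (ℤ.- a) x<a+L)

index-interval : ∀ {a L i} → i < L → InInterval a L (a ℤ.+ + i)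
index-interval {a} i<L = ℤP.i≤i+j a (+ _) , ℤP.+-monoʳ-< a (ℤ.+<+ i<L)

module Combinations (L : ℕ) where

  -- The counterpart of APComb for sets of indices i < L: a set is a Boolean predicate, so that it can
  -- be counted, and the differences of its constituent APs divide M.
  data Comb (M : ℕ) : ℕ → (ℕ → Bool) → Set where
    leaf  : ∀ {S} m q n → 1 ≤ q → q ∣ M → (∀ i → T (S i) ⇔ InAPℕ m q n i)
          → (∀ i → T (S i) → i < L) → Comb M 1 S
    union : ∀ {k l P Q S} → Comb M k P → Comb M l Q
          → (∀ i → (P ∩ Q) i ≡ false) → (∀ i → S i ≡ (P ∪ Q) i) → Comb M (k + l) S
    diff  : ∀ {k l P Q S} → Comb M k P → Comb M l Q
          → (∀ i → T (Q i) → T (P i)) → (∀ i → S i ≡ (P ∩ ∁ Q) i) → Comb M (k + l) S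

  comb-⊆ : ∀ {M k S} → Comb M k S → ∀ i → T (S i) → i < L
  comb-⊆ (leaf _ _ _ _ _ _ S<L) i Si = S<L i Si
  comb-⊆ (union {P = P} cP cQ _ S≡P∪Q) i Si with to (T-∨ {P i}) (subst T (S≡P∪Q i) Si)
  ... | inj₁ Pi = comb-⊆ cP i Pi
  ... | inj₂ Qi = comb-⊆ cQ i Qi
  comb-⊆ (diff {P = P} cP _ _ S≡P∖Q) i Si =
    comb-⊆ cP i (proj₁ (to (T-∧ {P i}) (subst T (S≡P∖Q i) Si)))

  restrict : ∀ {M M′ k S R} → RestrictsToAP M M′ R → Comb M k S → Comb M′ k (S ∩ R)
  restrict {S = S} R-AP (leaf m q n 1≤q q∣M S≈AP S<L) with R-AP m q n 1≤q q∣M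
  ... | m′ , q′ , n′ , 1≤q′ , q′∣M′ , AP∩R≈AP′ = leaf m′ q′ n′ 1≤q′ q′∣M′
    (λ i → ⇔.trans T-∧ (⇔.trans (S≈AP i ×-⇔ ⇔.refl) (AP∩R≈AP′ i)))
    (λ i Si∧Ri → S<L i (proj₁ (to (T-∧ {S i}) Si∧Ri)))
  restrict {R = R} R-AP (union {P = P} {Q} cP cQ P∩Q≡∅ S≡P∪Q) =
    union (restrict R-AP cP) (restrict R-AP cQ) (∩-disjoint {P} {Q} R P∩Q≡∅) (∩-distribʳ-∪ {P} {Q} R S≡P∪Q)
  restrict {R = R} R-AP (diff {P = P} {Q} cP cQ Q⊆P S≡P∖Q) =
    diff (restrict R-AP cP) (restrict R-AP cQ) (∩-monoˡ-⊆ {P} {Q} R Q⊆P) (∩-distribʳ-∖ {P} {Q} R S≡P∖Q)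

  toAPComb : ∀ a {M k S} → Comb M k S → (X : ISet) → (∀ x → X x ⇔ Shifted a S x)
           → APComb (λ q → q ℤd.∣ + M) k X
  toAPComb a (leaf m q n _ q∣M S≈AP _) X X≈S =
    single (a ℤ.+ + m) (+ q) n q∣M (λ x → ⇔.trans (X≈S x) (Shifted-AP a S≈AP))
  toAPComb a (union cP cQ P∩Q≡∅ S≡P∪Q) X X≈S =
    union (toAPComb a cP _ (λ _ → ⇔.refl)) (toAPComb a cQ _ (λ _ → ⇔.refl))
          (λ _ → Shifted-disjoint a P∩Q≡∅) (λ x → ⇔.trans (X≈S x) (Shifted-∪ a S≡P∪Q))
  toAPComb a (diff cP cQ Q⊆P S≡P∖Q) X X≈S =
    diff (toAPComb a cP _ (λ _ → ⇔.refl)) (toAPComb a cQ _ (λ _ → ⇔.refl))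
         (λ _ → Shifted-mono a Q⊆P) (λ x → ⇔.trans (X≈S x) (Shifted-∖ a S≡P∖Q))

  # : (ℕ → Bool) → ℕ
  # P = count P (upTo L)

  discrepancy : (ℕ → Bool) → (ℕ → Bool) → ℕ → ℤ
  discrepancy S D d = + # (S ∩ D) ℤ.* + d ℤ.- + # S

  discrepancy-+ : ∀ {P Q S D} d → # S ≡ # P + # Q → # (S ∩ D) ≡ # (P ∩ D) + # (Q ∩ D)
                → discrepancy S D d ≡ discrepancy P D d ℤ.+ discrepancy Q D d
  discrepancy-+ {P} {Q} {S} {D} d #S≡ #S∩D≡ = begin
    + # (S ∩ D) ℤ.* + d ℤ.- + # S
      ≡⟨ cong₂ (λ x y → x ℤ.* + d ℤ.- y) (trans (cong +_ #S∩D≡) (ℤP.pos-+ (# (P ∩ D)) _))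
                                          (trans (cong +_ #S≡) (ℤP.pos-+ (# P) _)) ⟩
    (+ # (P ∩ D) ℤ.+ + # (Q ∩ D)) ℤ.* + d ℤ.- (+ # P ℤ.+ + # Q)
      ≡⟨ regroup (+ # (P ∩ D)) (+ # (Q ∩ D)) (+ d) (+ # P) (+ # Q) ⟩
    discrepancy P D d ℤ.+ discrepancy Q D d
      ∎
    where
    open ≡-Reasoning
    regroup : ∀ x y d s t → (x ℤ.+ y) ℤ.* d ℤ.- (s ℤ.+ t) ≡ (x ℤ.* d ℤ.- s) ℤ.+ (y ℤ.* d ℤ.- t)
    regroup = ℤsolve-∀

  discrepancy-bound : ∀ {M k S} → Comb M k S → ∀ {d D R} .{{_ : ℕ.NonZero d}}
                    → (∀ {q} → q ∣ M → Coprime d q) → (∀ i → T (D i) ⇔ d ∣ R + i)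
                    → ∣ discrepancy S D d ∣ ≤ k * d
  discrepancy-bound {S = S} (leaf m q n 1≤q q∣M S≈AP S<L) {d} {D} {R} coprime D≈ 
    with AP-∩-residue (coprime q∣M) R m n
  ... | i₀ , i₀<d , n′ , below , AP∩D≈AP′ = begin
    ∣ discrepancy S D d ∣         ≡⟨ cong₂ (λ x y → ∣ + x ℤ.* + d ℤ.- + y ∣) #S∩D≡n′ #S≡n ⟩
    ∣ + n′ ℤ.* + d ℤ.- + n ∣     ≤⟨ residue-count-error i₀ d n n′ i₀<d below ⟩
    d                             ≡⟨ ℕP.*-identityˡ d ⟨
    1 * d                         ∎
    where
    open ℕP.≤-Reasoning
    #S≡n : # S ≡ n
    #S≡n = count-AP L 1≤q S≈AP S<L
    #S∩D≡n′ : # (S ∩ D) ≡ n′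
    #S∩D≡n′ = count-AP L (ℕP.*-mono-≤ (ℕ.>-nonZero⁻¹ d) 1≤q)
      (λ i → ⇔.trans T-∧ (⇔.trans (S≈AP i ×-⇔ D≈ i) (AP∩D≈AP′ i)))
      (λ i Si∧Di → S<L i (proj₁ (to (T-∧ {S i}) Si∧Di)))
  discrepancy-bound (union {k} {l} {P} {Q} {S} cP cQ P∩Q≡∅ S≡P∪Q) {d} {D} coprime D≈ = begin
    ∣ discrepancy S D d ∣                            ≡⟨ cong ∣_∣ S≡P+Q ⟩
    ∣ discrepancy P D d ℤ.+ discrepancy Q D d ∣     ≤⟨ ℤP.∣i+j∣≤∣i∣+∣j∣ (discrepancy P D d) _ ⟩
    ∣ discrepancy P D d ∣ + ∣ discrepancy Q D d ∣   ≤⟨ ℕP.+-mono-≤ (discrepancy-bound cP coprime D≈)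
                                                                    (discrepancy-bound cQ coprime D≈) ⟩
    k * d + l * d                                    ≡⟨ ℕP.*-distribʳ-+ d k l ⟨
    (k + l) * d                                      ∎
    where
    open ℕP.≤-Reasoning
    S≡P+Q : discrepancy S D d ≡ discrepancy P D d ℤ.+ discrepancy Q D d
    S≡P+Q = discrepancy-+ d (count-∪ P∩Q≡∅ S≡P∪Q (upTo L))
                            (count-∪ (∩-disjoint {P} {Q} D P∩Q≡∅) (∩-distribʳ-∪ {P} {Q} D S≡P∪Q) (upTo L))
  discrepancy-bound (diff {k} {l} {P} {Q} {S} cP cQ Q⊆P S≡P∖Q) {d} {D} coprime D≈ = begin
    ∣ discrepancy S D d ∣                            ≡⟨ cong ∣_∣ (x≈z//y (discrepancy S D d) _ _ (sym P≡S+Q)) ⟩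
    ∣ discrepancy P D d ℤ.- discrepancy Q D d ∣     ≤⟨ ℤP.∣i-j∣≤∣i∣+∣j∣ (discrepancy P D d) _ ⟩
    ∣ discrepancy P D d ∣ + ∣ discrepancy Q D d ∣   ≤⟨ ℕP.+-mono-≤ (discrepancy-bound cP coprime D≈)
                                                                    (discrepancy-bound cQ coprime D≈) ⟩
    k * d + l * d                                    ≡⟨ ℕP.*-distribʳ-+ d k l ⟨
    (k + l) * d                                      ∎
    where
    open ℕP.≤-Reasoning
    P≡S+Q : discrepancy P D d ≡ discrepancy S D d ℤ.+ discrepancy Q D d
    P≡S+Q = discrepancy-+ d (count-∖ Q⊆P S≡P∖Q (upTo L))
                            (count-∖ (∩-monoˡ-⊆ {P} {Q} D Q⊆P) (∩-distribʳ-∖ {P} {Q} D S≡P∖Q) (upTo L))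

  comb-Cut : ∀ {M M′ k S D} c → RestrictsToAP M M′ D → (∀ {q} → q ∣ M → q ∣ M′)
           → Comb M k S → Comb M′ (k + k) (Cut D S c)
  comb-Cut {S = S} {D} c D-AP M⇒M′ cS =
    diff (restrict (below-restricts c M⇒M′) cS) (restrict D-AP (restrict (below-restricts c id) cS))
         (λ i → proj₁ ∘ to (T-∧ {(S ∩ below c) i}))
         (λ i → lemma (S i) (below c i) (D i))
    where
    lemma : ∀ x y z → x ∧ (y ∧ not z) ≡ (x ∧ y) ∧ not ((x ∧ y) ∧ z)
    lemma true  true  true  = refl
    lemma true  true  false = refl
    lemma true  false _     = refl
    lemma false _     _     = refl

  comb-Rest : ∀ {M M′ k S D} c → RestrictsToAP M M′ D → (∀ {q} → q ∣ M → q ∣ M′)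
            → Comb M k S → Comb M′ (k + k) (Rest D S c)
  comb-Rest {S = S} {D} c D-AP M⇒M′ cS =
    union (restrict (above-restricts c M⇒M′) cS) (restrict D-AP (restrict (below-restricts c id) cS))
          (λ i → disjoint (S i) (below c i) (D i))
          (λ i → lemma (S i) (below c i) (D i))
    where
    disjoint : ∀ x y z → (x ∧ not y) ∧ ((x ∧ y) ∧ z) ≡ false
    disjoint true  true  _ = refl
    disjoint true  false _ = refl
    disjoint false _     _ = refl
    lemma : ∀ x y z → x ∧ not (y ∧ not z) ≡ (x ∧ not y) ∨ ((x ∧ y) ∧ z)
    lemma true  true  true  = refl
    lemma true  true  false = refl
    lemma true  false _     = refl
    lemma false _     _     = refl

  #Cut-zero : ∀ D S → # (Cut D S 0) ≡ 0
  #Cut-zero D S = count-none (upTo L) (λ {i} _ Cut₀ →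
    ℕP.n≮0 (to (T-does (i ℕ.<? 0)) (proj₁ (to (T-∧ {below 0 i} {not (D i)}) (proj₂ (to (T-∧ {S i}) Cut₀))))))

  #Cut-suc : ∀ D S s → # (Cut D S (suc s)) ≤ suc (# (Cut D S s))
  #Cut-suc D S s = begin
    # (Cut D S (suc s))                        ≤⟨ count-subadditive new-is-s (upTo L) ⟩
    # (Cut D S s) + # (λ i → does (i ℕ.≟ s))   ≤⟨ ℕP.+-monoʳ-≤ (# (Cut D S s))
                                                                  (count-≟-unique s (Unique.upTo⁺ L)) ⟩
    # (Cut D S s) + 1                          ≡⟨ ℕP.+-comm _ 1 ⟩
    suc (# (Cut D S s))                        ∎
    where
    open ℕP.≤-Reasoning
    new-is-s : ∀ i → T (Cut D S (suc s) i) → T (Cut D S s i) ⊎ T (does (i ℕ.≟ s))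
    new-is-s i Cut′ with to (T-∧ {S i}) Cut′
    ... | Si , i<1+s∧¬Di with to (T-∧ {below (suc s) i}) i<1+s∧¬Di
    ... | i<1+s , ¬Di with ℕP.m<1+n⇒m<n∨m≡n (to (T-does (i ℕ.<? suc s)) i<1+s)
    ... | inj₁ i<s  = inj₁ (from T-∧ (Si , from T-∧ (from (T-does (i ℕ.<? s)) i<s , ¬Di)))
    ... | inj₂ i≡s  = inj₂ (from (T-does (i ℕ.≟ s)) i≡s)

  #Cut-L : ∀ D S → # (Cut D S L) ≡ # (S ∩ ∁ D)
  #Cut-L D S = count-cong-∈ (upTo L) (λ {i} i∈ →
    cong (λ b → S i ∧ (b ∧ not (D i))) (to T-≡ (from (T-does (i ℕ.<? L)) (∈-upTo⁻ i∈))))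

  cutoff : (ℕ → Bool) → (ℕ → Bool) → ℕ → ℕ
  cutoff D S h = crossing (λ c → # (Cut D S c)) h L

  #Cut-cutoff : ∀ {M k S d D R} h .{{_ : ℕ.NonZero d}} → Comb M k S → (∀ {q} → q ∣ M → Coprime d q)
              → (∀ i → T (D i) ⇔ d ∣ R + i) → 3 ≤ d → 4 * k ≤ h → # S ≡ h + h
              → # (Cut D S (cutoff D S h)) ≡ h
  #Cut-cutoff {k = k} {S} {d} {D} h cS coprime D≈ 3≤d 4k≤h #S≡2h =
    crossing-correct (λ c → # (Cut D S c)) h L (#Cut-zero D S) (#Cut-suc D S)
                     (subst (h ≤_) (sym (#Cut-L D S)) h≤#S∖D)
    where
    #S∩D*d≤#S+kd : # (S ∩ D) * d ≤ # S + k * d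
    #S∩D*d≤#S+kd = ∣m-n∣≤k⇒m≤n+k
      (subst (λ x → ∣ x ℤ.- + # S ∣ ≤ k * d) (sym (ℤP.pos-* (# (S ∩ D)) d)) (discrepancy-bound cS coprime D≈))
    #S∩D≤h : # (S ∩ D) ≤ h
    #S∩D≤h = ≤-from-scaled (# (S ∩ D)) h k d 3≤d 4k≤h
               (subst (λ n → # (S ∩ D) * d ≤ n + k * d) #S≡2h #S∩D*d≤#S+kd)
    h≤#S∖D : h ≤ # (S ∩ ∁ D)
    h≤#S∖D = ℕP.+-cancelʳ-≤ h h (# (S ∩ ∁ D)) (begin
      h + h                      ≡⟨ #S≡2h ⟨
      # S                        ≡⟨ count-split S D (upTo L) ⟩
      # (S ∩ ∁ D) + # (S ∩ D)    ≤⟨ ℕP.+-monoʳ-≤ (# (S ∩ ∁ D)) #S∩D≤h ⟩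
      # (S ∩ ∁ D) + h            ∎)
      where open ℕP.≤-Reasoning

  #Rest-cutoff : ∀ {D S} h c → # S ≡ h + h → # (Cut D S c) ≡ h → # (Rest D S c) ≡ h
  #Rest-cutoff {D} {S} h c #S≡2h #Cut≡h = ℕP.+-cancelʳ-≡ h (# (Rest D S c)) h (begin
    # (Rest D S c) + h              ≡⟨ cong (_+_ (# (Rest D S c))) #Cut≡h ⟨
    # (Rest D S c) + # (Cut D S c)  ≡⟨ count-split S (below c ∩ ∁ D) (upTo L) ⟨
    # S                             ≡⟨ #S≡2h ⟩
    h + h                           ∎)
    where open ≡-Reasoning

-- Divisibility

∣a+i∣-residue : ∀ a d .{{_ : ℕ.NonZero d}} i → (d ∣ ∣ a ℤ.+ + i ∣) ⇔ (d ∣ a %ℕ d + i)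
∣a+i∣-residue a d i = mk⇔
  (λ d∣ → Sg.∣⇒∣ᵤ {+ d} {+ (r + i)}
            (Sg.∣m+n∣n⇒∣m (subst (+ d Sg.∣_) split (Sg.∣ᵤ⇒∣ {+ d} {a ℤ.+ + i} d∣)) d∣kd))
  (λ d∣ → Sg.∣⇒∣ᵤ {+ d} {a ℤ.+ + i}
            (subst (+ d Sg.∣_) (sym split) (Sg.∣m∣n⇒∣m+n (Sg.∣ᵤ⇒∣ {+ d} {+ (r + i)} d∣) d∣kd)))
  where
  r = a %ℕ d
  k = a /ℕ d
  regroup : ∀ r k d i → (r ℤ.+ k ℤ.* d) ℤ.+ i ≡ (r ℤ.+ i) ℤ.+ k ℤ.* d
  regroup = ℤsolve-∀
  split : a ℤ.+ + i ≡ + (r + i) ℤ.+ k ℤ.* + d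
  split = begin
    a ℤ.+ + i                       ≡⟨ cong (ℤ._+ + i) (a≡a%ℕn+[a/ℕn]*n a d) ⟩
    (+ r ℤ.+ k ℤ.* + d) ℤ.+ + i     ≡⟨ regroup (+ r) k (+ d) (+ i) ⟩
    (+ r ℤ.+ + i) ℤ.+ k ℤ.* + d     ≡⟨ cong (ℤ._+ k ℤ.* + d) (ℤP.pos-+ r i) ⟨
    + (r + i) ℤ.+ k ℤ.* + d         ∎
    where open ≡-Reasoning
  d∣kd : + d Sg.∣ k ℤ.* + d
  d∣kd = Sg.∣n⇒∣m*n k Sg.∣-refl

2∤⇒2∣suc : ∀ m → ¬ 2 ∣ m → 2 ∣ suc m
2∤⇒2∣suc zero          2∤0 = ⊥-elim (2∤0 (2 ∣0))
2∤⇒2∣suc (suc zero)    _   = ∣-refl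
2∤⇒2∣suc (suc (suc m)) 2∤m+2 =
  ∣m∣n⇒∣m+n (∣-refl {2}) (2∤⇒2∣suc m (2∤m+2 ∘ ∣m∣n⇒∣m+n ∣-refl))

2∣suc⇒2∤ : ∀ m → 2 ∣ suc m → ¬ 2 ∣ m
2∣suc⇒2∤ m 2∣1+m 2∣m with ∣1⇒≡1 (∣m+n∣m⇒∣n (subst (2 ∣_) (ℕP.+-comm 1 m) 2∣1+m) 2∣m)
... | ()

coprime-* : ∀ {x u v} → Coprime x u → Coprime x v → Coprime x (u * v)
coprime-* {x} {u} {v} x⊥u x⊥v {i} (i∣x , i∣uv) =
  x⊥u (i∣x , coprime-divisor i⊥v (subst (i ∣_) (ℕP.*-comm u v) i∣uv))
  where
  i⊥v : Coprime i v
  i⊥v (j∣i , j∣v) = x⊥v (∣-trans j∣i i∣x , j∣v)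

∤-prime⇒coprime : ∀ {p x} → Prime p → ¬ p ∣ x → Coprime x p
∤-prime⇒coprime p-prime p∤x {i} (i∣x , i∣p) with prime⇒irreducible p-prime i∣p
... | inj₁ i≡1    = i≡1
... | inj₂ refl   = ⊥-elim (p∤x i∣x)

coprime-1 : ∀ x → Coprime x 1
coprime-1 x = Cop.sym (1-coprimeTo x)

coprime-∣ʳ : ∀ {d M q} → Coprime d M → q ∣ M → Coprime d q
coprime-∣ʳ d⊥M q∣M (i∣d , i∣q) = d⊥M (i∣d , ∣-trans i∣q q∣M)

prime>1 : ∀ {p} → Prime p → 1 < p
prime>1 {p} p-prime = ℕ.nonTrivial⇒n>1 p {{prime⇒nonTrivial p-prime}}

primorial-∤ : ∀ (p : ℕ → ℕ) j {q} → Prime q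
            → (∀ i → 1 ≤ i → i ≤ j → Prime (p i)) → (∀ i → 1 ≤ i → i ≤ j → p i < q)
            → ¬ q ∣ primorial p j
primorial-∤ p zero       q-prime _ _ q∣1 = ℕP.<-irrefl (sym (∣1⇒≡1 q∣1)) (prime>1 q-prime)
primorial-∤ p (suc j) {q} q-prime p-prime p<q q∣ with euclidsLemma (primorial p j) (p (suc j)) q-prime q∣
... | inj₁ q∣primorial = primorial-∤ p j q-prime (λ i 1≤i i≤j → p-prime i 1≤i (ℕP.m≤n⇒m≤1+n i≤j))
                                                 (λ i 1≤i i≤j → p<q i 1≤i (ℕP.m≤n⇒m≤1+n i≤j)) q∣primorial
... | inj₂ q∣pⱼ₊₁ with prime⇒irreducible (p-prime (suc j) (s≤s z≤n) ℕP.≤-refl) q∣pⱼ₊₁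
...   | inj₁ q≡1 = ℕP.<-irrefl (sym q≡1) (prime>1 q-prime)
...   | inj₂ q≡p = ℕP.<-irrefl (sym q≡p) (p<q (suc j) (s≤s z≤n) ℕP.≤-refl)

p₁∣primorial : ∀ (p : ℕ → ℕ) j → 1 ≤ j → p 1 ∣ primorial p j
p₁∣primorial p (suc zero)    _ = n∣m*n 1
p₁∣primorial p (suc (suc j)) _ = ∣m⇒∣m*n (p (suc (suc j))) (p₁∣primorial p (suc j) (s≤s z≤n))

private
  same-initial-segment : ∀ {m n} → (∀ s → s < m ⇔ s < n) → m ≡ n
  same-initial-segment {m} {n} h = ℕP.≤-antisym (ℕP.≮⇒≥ (λ n<m → ℕP.<-irrefl refl (to (h n) n<m)))
                                                (ℕP.≮⇒≥ (λ m<n → ℕP.<-irrefl refl (from (h m) m<n)))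

  halves : ∀ i₀ s h → i₀ < 2 → i₀ + s * 2 < h + h ⇔ s < h
  halves i₀ s h (s≤s i₀≤1) = mk⇔
    (λ lt → ℕP.≰⇒> (λ h≤s → ℕP.<⇒≱ lt (begin
      h + h          ≤⟨ ℕP.+-mono-≤ h≤s h≤s ⟩
      s + s          ≡⟨ double s ⟩
      s * 2          ≤⟨ ℕP.m≤n+m (s * 2) i₀ ⟩
      i₀ + s * 2     ∎)))
    (λ s<h → begin-strict
      i₀ + s * 2     ≤⟨ ℕP.+-monoˡ-≤ (s * 2) i₀≤1 ⟩
      1 + s * 2      ≡⟨ cong suc (double s) ⟨
      1 + (s + s)    <⟨ ℕP.≤-reflexive (sym (ℕP.+-suc (suc s) s)) ⟩
      suc s + suc s  ≤⟨ ℕP.+-mono-≤ s<h s<h ⟩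
      h + h          ∎)
    where
    open ℕP.≤-Reasoning
    double : ∀ s → s + s ≡ s * 2
    double = solve-∀

  interval-AP : ∀ L i → T (below L i) ⇔ InAPℕ 0 1 L i
  interval-AP L i = mk⇔
    (λ i<L → i , to (T-does (i ℕ.<? L)) i<L , sym (ℕP.*-identityʳ i))
    (λ { (t , t<L , refl) → from (T-does (_ ℕ.<? L)) (subst (_< L) (sym (ℕP.*-identityʳ t)) t<L) })

count-parity-class : ∀ {D} R L h → L ≡ h + h → (∀ i → T (D i) ⇔ 2 ∣ R + i)
                   → count (below L ∩ D) (upTo L) ≡ h
count-parity-class {D} R L h refl D≈ with AP-∩-residue {2} {1} (coprime-1 2) R 0 L
... | i₀ , i₀<2 , n′ , terms , AP∩D≈AP′ =
  trans #≡n′ (same-initial-segment (λ s → ⇔.trans (terms s) (halves i₀ s h i₀<2)))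
  where
  #≡n′ : count (below L ∩ D) (upTo L) ≡ n′
  #≡n′ = count-AP L (s≤s z≤n) (λ i → ⇔.trans T-∧ (⇔.trans (interval-AP L i ×-⇔ D≈ i) (AP∩D≈AP′ i)))
                     (λ i L∩D → to (T-does (i ℕ.<? L)) (proj₁ (to (T-∧ {below L i}) L∩D)))

-- The construction

module Construction
  (p : ℕ → ℕ) (J : ℕ) (1≤J : 1 ≤ J) (p-prime : ∀ i → 1 ≤ i → i ≤ J → Prime (p i))
  (p-increasing : ∀ i k → 1 ≤ i → i < k → k ≤ J → p i < p k) (p₁≡2 : p 1 ≡ 2)
  (a : ℤ) (L t : ℕ) (L≡2^J*t : L ≡ 2 ^ J * t) (4^J≤L : 4 ^ J ≤ L) where

  open Combinations L

  divisibleBy : ℕ → ℕ → Bool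
  divisibleBy d i = does (d ∣? ∣ a ℤ.+ + i ∣)

  divisibleBy-residue : ∀ d .{{_ : ℕ.NonZero d}} i → T (divisibleBy d i) ⇔ d ∣ a %ℕ d + i
  divisibleBy-residue d i = ⇔.trans (T-does (d ∣? ∣ a ℤ.+ + i ∣)) (∣a+i∣-residue a d i)

  record Partition (j : ℕ) : Set where
    field
      part     : ℕ → ℕ → Bool
      comb     : ∀ {v} → v ∣ primorial p j → Comb (primorial p j) (2 ^ (j ∸ 1)) (part v)
      cover    : ∀ {i} → i < L → Σ ℕ λ v → v ∣ primorial p j × T (part v i)
      disjoint : ∀ {v w i} → v ∣ primorial p j → w ∣ primorial p j → T (part v i) → T (part w i) → v ≡ w
      size     : ∀ {v} → v ∣ primorial p j → # (part v) ≡ 2 ^ (J ∸ j) * t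
      coprime  : ∀ {v} → v ∣ primorial p j → ∀ {i} → T (part v i) → Coprime ∣ a ℤ.+ + i ∣ v

  2^J≤t : 2 ^ J ≤ t
  2^J≤t = ℕP.*-cancelˡ-≤ (2 ^ J) {{ℕP.m^n≢0 2 J}} (subst₂ _≤_ (4^n≡2^n*2^n J) L≡2^J*t 4^J≤L)

  size-halves : ∀ j → j < J → 2 ^ (J ∸ j) * t ≡ 2 ^ (J ∸ suc j) * t + 2 ^ (J ∸ suc j) * t
  size-halves j j<J = trans (cong (λ e → 2 ^ e * t) (ℕP.+-∸-assoc 1 j<J)) (double (2 ^ (J ∸ suc j)) t)
    where
    double : ∀ x t → 2 * x * t ≡ x * t + x * t
    double = solve-∀

  module Base where
    M₁ : ℕ
    M₁ = primorial p 1

    p₁-prime : Prime (p 1)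
    p₁-prime = p-prime 1 ℕP.≤-refl 1≤J

    divisors : ∀ {v} → v ∣ M₁ → v ≡ 1 ⊎ v ≡ 2
    divisors v∣M₁ with prime⇒irreducible p₁-prime (subst (_ ∣_) (ℕP.*-identityˡ (p 1)) v∣M₁)
    ... | inj₁ v≡1  = inj₁ v≡1
    ... | inj₂ v≡p₁ = inj₂ (trans v≡p₁ p₁≡2)

    even odd : ℕ → Bool
    even = below L ∩ divisibleBy 2
    odd  = below L ∩ ∁ (divisibleBy 2)

    odd-residue : ∀ i → T (∁ (divisibleBy 2) i) ⇔ 2 ∣ suc (a %ℕ 2) + i
    odd-residue i =
      ⇔.trans T-not (⇔.trans (¬-cong-⇔ (divisibleBy-residue 2 i)) (mk⇔ (2∤⇒2∣suc _) (2∣suc⇒2∤ _)))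

    2-restricts : ∀ {D} R → (∀ i → T (D i) ⇔ 2 ∣ R + i) → RestrictsToAP 1 M₁ D
    2-restricts R = residue-restricts R (λ q∣1 → subst (Coprime 2) (sym (∣1⇒≡1 q∣1)) (coprime-1 2)) 2q∣M₁
      where
      2q∣M₁ : ∀ {q} → q ∣ 1 → 2 * q ∣ M₁
      2q∣M₁ q∣1 rewrite ∣1⇒≡1 q∣1 | p₁≡2 = ∣-refl

    interval : Comb 1 1 (below L)
    interval = leaf 0 1 L ℕP.≤-refl ∣-refl (interval-AP L) (λ i → to (T-does (i ℕ.<? L)))

    h₁ : ℕ
    h₁ = 2 ^ (J ∸ 1) * t

    L≡h₁+h₁ : L ≡ h₁ + h₁
    L≡h₁+h₁ = trans L≡2^J*t (size-halves 0 1≤J)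

    odd≢even : ∀ i → T (odd i) → ¬ T (even i)
    odd≢even i oddᵢ evenᵢ = to T-not (proj₂ (to (T-∧ {below L i}) oddᵢ)) (proj₂ (to (T-∧ {below L i}) evenᵢ))

    partition : Partition 1
    partition = record
      { part = part ; comb = comb ; cover = cover ; disjoint = disjoint ; size = size ; coprime = coprime }
      where
      part : ℕ → ℕ → Bool
      part v = if does (2 ∣? v) then odd else even
      comb : ∀ {v} → v ∣ M₁ → Comb M₁ 1 (part v)
      comb v∣M₁ with divisors v∣M₁
      ... | inj₁ refl = restrict (2-restricts (a %ℕ 2) (divisibleBy-residue 2)) interval
      ... | inj₂ refl = restrict (2-restricts (suc (a %ℕ 2)) odd-residue) interval
      cover : ∀ {i} → i < L → Σ ℕ λ v → v ∣ M₁ × T (part v i)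
      cover {i} i<L with divisibleBy 2 i in 2∣?
      ... | true  = 1 , 1∣ M₁ ,
        from T-∧ (from (T-does (i ℕ.<? L)) i<L , subst T (sym 2∣?) _)
      ... | false = 2 , subst (_∣ M₁) p₁≡2 (n∣m*n 1) ,
        from T-∧ (from (T-does (i ℕ.<? L)) i<L , subst (T ∘ not) (sym 2∣?) _)
      disjoint : ∀ {v w i} → v ∣ M₁ → w ∣ M₁ → T (part v i) → T (part w i) → v ≡ w
      disjoint {i = i} v∣M₁ w∣M₁ partᵥᵢ part-wᵢ with divisors v∣M₁ | divisors w∣M₁
      ... | inj₁ refl | inj₁ refl = refl
      ... | inj₂ refl | inj₂ refl = refl
      ... | inj₁ refl | inj₂ refl = ⊥-elim (odd≢even i part-wᵢ partᵥᵢ)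
      ... | inj₂ refl | inj₁ refl = ⊥-elim (odd≢even i partᵥᵢ part-wᵢ)
      size : ∀ {v} → v ∣ M₁ → # (part v) ≡ h₁
      size v∣M₁ with divisors v∣M₁
      ... | inj₁ refl = count-parity-class (a %ℕ 2) L h₁ L≡h₁+h₁ (divisibleBy-residue 2)
      ... | inj₂ refl = count-parity-class (suc (a %ℕ 2)) L h₁ L≡h₁+h₁ odd-residue
      coprime : ∀ {v} → v ∣ M₁ → ∀ {i} → T (part v i) → Coprime ∣ a ℤ.+ + i ∣ v
      coprime v∣M₁ {i} partᵥᵢ with divisors v∣M₁
      ... | inj₁ refl = coprime-1 _
      ... | inj₂ refl = ∤-prime⇒coprime (subst Prime p₁≡2 p₁-prime)
                          (to T-not (proj₂ (to (T-∧ {below L i}) partᵥᵢ)) ∘ from (T-does (2 ∣? ∣ a ℤ.+ + i ∣)))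

  module Step {j} (1≤j : 1 ≤ j) (j<J : j < J) (P : Partition j) where
    open Partition P

    M M′ p′ k h : ℕ
    M  = primorial p j
    M′ = primorial p (suc j)
    p′ = p (suc j)
    k  = 2 ^ (j ∸ 1)
    h  = 2 ^ (J ∸ suc j) * t

    p′-prime : Prime p′
    p′-prime = p-prime (suc j) (s≤s z≤n) j<J

    instance
      p′≢0 : ℕ.NonZero p′
      p′≢0 = prime⇒nonZero p′-prime

    p′∤M : ¬ p′ ∣ M
    p′∤M = primorial-∤ p j p′-prime (λ i 1≤i i≤j → p-prime i 1≤i (ℕP.≤-trans i≤j (ℕP.<⇒≤ j<J)))
                                    (λ i 1≤i i≤j → p-increasing i (suc j) 1≤i (s≤s i≤j) j<J)

    p′⊥M : ∀ {q} → q ∣ M → Coprime p′ q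
    p′⊥M q∣M = Cop.sym (∤-prime⇒coprime p′-prime (λ p′∣q → p′∤M (∣-trans p′∣q q∣M)))

    D : ℕ → Bool
    D = divisibleBy p′

    M∣M′ : ∀ {q} → q ∣ M → q ∣ M′
    M∣M′ = ∣m⇒∣m*n p′

    D-restricts : RestrictsToAP M M′ D
    D-restricts = residue-restricts (a %ℕ p′) p′⊥M p′M∣M′ (divisibleBy-residue p′)
      where
      p′M∣M′ : ∀ {q} → q ∣ M → p′ * q ∣ M′
      p′M∣M′ {q} q∣M = subst (_∣ M′) (ℕP.*-comm q p′) (*-monoˡ-∣ p′ q∣M)

    3≤p′ : 3 ≤ p′
    3≤p′ = subst (_< p′) p₁≡2 (p-increasing 1 (suc j) ℕP.≤-refl (s≤s 1≤j) j<J)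

    4k≤h : 4 * k ≤ h
    4k≤h = begin
      4 * k       ≡⟨ 4*2^[n∸1]≡2^[1+n] j 1≤j ⟩
      2 ^ suc j   ≤⟨ ℕP.^-monoʳ-≤ 2 j<J ⟩
      2 ^ J       ≤⟨ 2^J≤t ⟩
      t           ≤⟨ ℕP.m≤n*m t (2 ^ (J ∸ suc j)) {{ℕP.m^n≢0 2 (J ∸ suc j)}} ⟩
      h           ∎
      where open ℕP.≤-Reasoning

    #part≡h+h : ∀ {u} → u ∣ M → # (part u) ≡ h + h
    #part≡h+h u∣M = trans (size u∣M) (size-halves j j<J)

    c : ℕ → ℕ
    c u = cutoff D (part u) h

    cut rest : ℕ → ℕ → Bool
    cut  u = Cut  D (part u) (c u)
    rest u = Rest D (part u) (c u)

    #cut≡h : ∀ {u} → u ∣ M → # (cut u) ≡ h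
    #cut≡h u∣M = #Cut-cutoff h (comb u∣M) p′⊥M (divisibleBy-residue p′) 3≤p′ 4k≤h (#part≡h+h u∣M)

    cut⊆part : ∀ u i → T (cut u i) → T (part u i)
    cut⊆part u i = proj₁ ∘ to (T-∧ {part u i})

    rest⊆part : ∀ u i → T (rest u i) → T (part u i)
    rest⊆part u i = proj₁ ∘ to (T-∧ {part u i})

    cut⊆∁D : ∀ u i → T (cut u i) → ¬ T (D i)
    cut⊆∁D u i = to T-not ∘ proj₂ ∘ to (T-∧ {below (c u) i}) ∘ proj₂ ∘ to (T-∧ {part u i})

    cut∩rest≡∅ : ∀ u i → T (cut u i) → ¬ T (rest u i)
    cut∩rest≡∅ u i cutᵢ restᵢ = to T-not (proj₂ (to (T-∧ {part u i}) restᵢ)) (proj₂ (to (T-∧ {part u i}) cutᵢ))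

    new-part : ∀ v → Dec (p′ ∣ v) → ℕ → Bool
    new-part v (yes _) = cut (v / p′)
    new-part v (no  _) = rest v

    quotient-∣M : ∀ {v} → p′ ∣ v → v ∣ M′ → v / p′ ∣ M
    quotient-∣M p′∣v v∣M′ = *-cancelʳ-∣ p′ (subst (_∣ M′) (sym (m/n*n≡m p′∣v)) v∣M′)

    ∤-∣M : ∀ {v} → ¬ p′ ∣ v → v ∣ M′ → v ∣ M
    ∤-∣M {v} p′∤v v∣M′ =
      coprime-divisor (∤-prime⇒coprime p′-prime p′∤v) (subst (v ∣_) (ℕP.*-comm M p′) v∣M′)

    new-comb : ∀ {v} (p′∣?v : Dec (p′ ∣ v)) → v ∣ M′ → Comb M′ (2 ^ (suc j ∸ 1)) (new-part v p′∣?v)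
    new-comb {v} (yes p′∣v) v∣M′ = subst (λ n → Comb M′ n (cut (v / p′))) (2^[n∸1]+2^[n∸1]≡2^n j 1≤j)
      (comb-Cut (c (v / p′)) D-restricts M∣M′ (comb (quotient-∣M p′∣v v∣M′)))
    new-comb {v} (no p′∤v)  v∣M′ = subst (λ n → Comb M′ n (rest v)) (2^[n∸1]+2^[n∸1]≡2^n j 1≤j)
      (comb-Rest (c v) D-restricts M∣M′ (comb (∤-∣M p′∤v v∣M′)))

    new-cover : ∀ {i} → i < L → Σ ℕ λ v → v ∣ M′ × T (new-part v (p′ ∣? v) i)
    new-cover {i} i<L with cover i<L
    ... | u , u∣M , partᵤᵢ with cut u i in cutᵤᵢ≡
    ...   | true  = u * p′ , *-monoˡ-∣ p′ u∣M , in-cut (p′ ∣? (u * p′))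
      where
      in-cut : (p′∣?up′ : Dec (p′ ∣ u * p′)) → T (new-part (u * p′) p′∣?up′ i)
      in-cut (yes _)     rewrite m*n/n≡m u p′ {{p′≢0}} | cutᵤᵢ≡ = _
      in-cut (no p′∤up′) = ⊥-elim (p′∤up′ (n∣m*n u))
    ...   | false = u , M∣M′ u∣M , in-rest (p′ ∣? u)
      where
      in-rest : (p′∣?u : Dec (p′ ∣ u)) → T (new-part u p′∣?u i)
      in-rest (yes p′∣u) = ⊥-elim (p′∤M (∣-trans p′∣u u∣M))
      in-rest (no _)     = from T-∧ (partᵤᵢ , from T-not (λ Xᵢ → subst T cutᵤᵢ≡ (from T-∧ (partᵤᵢ , Xᵢ))))

    new-disjoint : ∀ {v w i} (p′∣?v : Dec (p′ ∣ v)) (p′∣?w : Dec (p′ ∣ w)) → v ∣ M′ → w ∣ M′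
                 → T (new-part v p′∣?v i) → T (new-part w p′∣?w i) → v ≡ w
    new-disjoint {v} {w} {i} (yes p′∣v) (yes p′∣w) v∣M′ w∣M′ in-v in-w = begin
      v             ≡⟨ m/n*n≡m p′∣v ⟨
      v / p′ * p′   ≡⟨ cong (_* p′) (disjoint (quotient-∣M p′∣v v∣M′) (quotient-∣M p′∣w w∣M′)
                                              (cut⊆part _ i in-v) (cut⊆part _ i in-w)) ⟩
      w / p′ * p′   ≡⟨ m/n*n≡m p′∣w ⟩
      w             ∎
      where open ≡-Reasoning
    new-disjoint {i = i} (yes p′∣v) (no p′∤w) v∣M′ w∣M′ in-v in-w
      with refl ← disjoint (quotient-∣M p′∣v v∣M′) (∤-∣M p′∤w w∣M′)
                           (cut⊆part _ i in-v) (rest⊆part _ i in-w)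
      = ⊥-elim (cut∩rest≡∅ _ i in-v in-w)
    new-disjoint {i = i} (no p′∤v) (yes p′∣w) v∣M′ w∣M′ in-v in-w
      with refl ← disjoint (quotient-∣M p′∣w w∣M′) (∤-∣M p′∤v v∣M′)
                           (cut⊆part _ i in-w) (rest⊆part _ i in-v)
      = ⊥-elim (cut∩rest≡∅ _ i in-w in-v)
    new-disjoint {i = i} (no p′∤v) (no p′∤w) v∣M′ w∣M′ in-v in-w =
      disjoint (∤-∣M p′∤v v∣M′) (∤-∣M p′∤w w∣M′) (rest⊆part _ i in-v) (rest⊆part _ i in-w)

    new-size : ∀ {v} (p′∣?v : Dec (p′ ∣ v)) → v ∣ M′ → # (new-part v p′∣?v) ≡ h
    new-size (yes p′∣v) v∣M′ = #cut≡h (quotient-∣M p′∣v v∣M′)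
    new-size {v} (no p′∤v) v∣M′ = #Rest-cutoff h (c v) (#part≡h+h v∣M) (#cut≡h v∣M)
      where
      v∣M : v ∣ M
      v∣M = ∤-∣M p′∤v v∣M′

    new-coprime : ∀ {v} (p′∣?v : Dec (p′ ∣ v)) → v ∣ M′
                → ∀ {i} → T (new-part v p′∣?v i) → Coprime ∣ a ℤ.+ + i ∣ v
    new-coprime {v} (yes p′∣v) v∣M′ {i} cutᵢ = subst (Coprime ∣ a ℤ.+ + i ∣) (m/n*n≡m p′∣v)
      (coprime-* (coprime (quotient-∣M p′∣v v∣M′) (cut⊆part _ i cutᵢ))
                 (∤-prime⇒coprime p′-prime (cut⊆∁D _ i cutᵢ ∘ from (T-does (p′ ∣? ∣ a ℤ.+ + i ∣)))))
    new-coprime (no p′∤v) v∣M′ {i} restᵢ = coprime (∤-∣M p′∤v v∣M′) (rest⊆part _ i restᵢ)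

    partition : Partition (suc j)
    partition = record
      { part     = λ v → new-part v (p′ ∣? v)
      ; comb     = λ {v} → new-comb (p′ ∣? v)
      ; cover    = new-cover
      ; disjoint = λ {v} {w} → new-disjoint (p′ ∣? v) (p′ ∣? w)
      ; size     = λ {v} → new-size (p′ ∣? v)
      ; coprime  = λ {v} → new-coprime (p′ ∣? v)
      }

  partition : ∀ j → 1 ≤ j → j ≤ J → Partition j
  partition (suc zero)    _ _   = Base.partition
  partition (suc (suc j)) _ j<J =
    Step.partition (s≤s z≤n) j<J (partition (suc j) (s≤s z≤n) (ℕP.<⇒≤ j<J))

  module Final where
    open Partition (partition J 1≤J ℕP.≤-refl) public

    A : ℕ → List ℤ
    A v = listing a L (part v)

    ∈-A : ∀ {v x} → x ∈ A v ⇔ (Σ ℕ λ i → i < L × T (part v i) × x ≡ a ℤ.+ + i)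
    ∈-A {v} = ∈-listing {a} {L} {part v}

    A-⊆-interval : ∀ {v x} → x ∈ A v → InInterval a L x
    A-⊆-interval x∈A with to ∈-A x∈A
    ... | i , i<L , _ , refl = index-interval i<L

    A-covers : ∀ {x} → InInterval a L x → Σ ℕ λ v → v ∣ primorial p J × x ∈ A v
    A-covers x∈I with interval-index x∈I
    ... | i , i<L , refl with cover i<L
    ...   | v , v∣M , partᵥᵢ = v , v∣M , from ∈-A (i , i<L , partᵥᵢ , refl)

    A-disjoint : ∀ {x v w} → v ∣ primorial p J → w ∣ primorial p J → x ∈ A v → x ∈ A w → v ≡ w
    A-disjoint v∣M w∣M x∈Aᵥ x∈A-w with to ∈-A x∈Aᵥ | to ∈-A x∈A-w
    ... | i , _ , partᵥᵢ , refl | i′ , _ , part-wᵢ′ , a+i≡a+i′ with refl ← +-injectiveʳ a a+i≡a+i′ =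
      disjoint v∣M w∣M partᵥᵢ part-wᵢ′

    L/2^J≡t : divPow2 L J ≡ t
    L/2^J≡t = trans (cong (λ n → (n / 2 ^ J) {{ℕP.m^n≢0 2 J}}) (trans L≡2^J*t (ℕP.*-comm (2 ^ J) t)))
                    (m*n/n≡m t (2 ^ J) {{ℕP.m^n≢0 2 J}})

    A-length : ∀ {v} → v ∣ primorial p J → length (A v) ≡ divPow2 L J
    A-length {v} v∣M = begin
      length (A v)      ≡⟨ length-listing a L (part v) ⟩
      # (part v)        ≡⟨ size v∣M ⟩
      2 ^ (J ∸ J) * t   ≡⟨ cong (λ e → 2 ^ e * t) (ℕP.n∸n≡0 J) ⟩
      1 * t             ≡⟨ ℕP.*-identityˡ t ⟩
      t                 ≡⟨ L/2^J≡t ⟨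
      divPow2 L J       ∎
      where open ≡-Reasoning

    A-coprime : ∀ {v} → v ∣ primorial p J → ∀ {x} → x ∈ A v → Coprime ∣ x ∣ v
    A-coprime v∣M x∈A with to ∈-A x∈A
    ... | i , _ , partᵥᵢ , refl = coprime v∣M partᵥᵢ

    A-APComb : ∀ {v} → v ∣ primorial p J → APComb (λ q → q ℤd.∣ + primorial p J) (2 ^ (J ∸ 1)) (_∈ A v)
    A-APComb v∣M = toAPComb a (comb v∣M) (_∈ A _) (λ x → mk⇔
      (λ x∈A → let i , _ , partᵥᵢ , x≡ = to ∈-A x∈A in i , partᵥᵢ , x≡)
      (λ { (i , partᵥᵢ , refl) → from ∈-A (i , comb-⊆ (comb v∣M) i partᵥᵢ , partᵥᵢ , refl) }))

    A-discrepancy : ∀ {v} → v ∣ primorial p J → ∀ d → Coprime d (primorial p J)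
                  → ∣ + length (filter (λ x → d ∣? ∣ x ∣) (A v)) ℤ.* + d ℤ.- + length (A v) ∣
                    ≤ 2 ^ (J ∸ 1) * d
    A-discrepancy v∣M zero 0⊥M with () ← trans (sym p₁≡2) (0⊥M (p 1 ∣0 , p₁∣primorial p J 1≤J))
    A-discrepancy {v} v∣M d@(suc _) d⊥M =
      subst₂ (λ m n → ∣ + m ℤ.* + d ℤ.- + n ∣ ≤ 2 ^ (J ∸ 1) * d)
        (sym (length-filter-listing (λ x → d ∣? ∣ x ∣) a L (part v))) (sym (length-listing a L (part v)))
        (discrepancy-bound (comb v∣M) (coprime-∣ʳ d⊥M) (divisibleBy-residue d))

lemma3p5 : (j : ℕ) → 1 ≤ j → (p : ℕ → ℕ)
    → (∀ i → 1 ≤ i → i ≤ j → Prime (p i))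
    → (∀ i k → 1 ≤ i → i < k → k ≤ j → p i < p k)
    → p 1 ≡ 2
    → (a : ℤ) (L : ℕ) → 2 ^ j ∣ L → 4 ^ j ≤ L
    → Σ (ℕ → List ℤ) λ A →
        -- A v is (a duplicate-free listing of) the set A_{v,j}, for v ∣ m_j
        (∀ v → v ∣ primorial p j → Unique (A v))
        -- the A v (v ∣ m_j) partition the interval I = {a, ..., a+L-1}
      × (∀ v → v ∣ primorial p j → ∀ x → x ∈ A v → InInterval a L x)
      × (∀ x → InInterval a L x → Σ ℕ λ v → v ∣ primorial p j × x ∈ A v)
      × (∀ x v w → v ∣ primorial p j → w ∣ primorial p j
           → x ∈ A v → x ∈ A w → v ≡ w)
        -- sizes
      × (∀ v → v ∣ primorial p j → length (A v) ≡ divPow2 L j)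
        -- coprimality with v
      × (∀ v → v ∣ primorial p j → ∀ x → x ∈ A v → Coprime ∣ x ∣ v)
        -- 2^(j-1)-AP combination with differences dividing m_j
      × (∀ v → v ∣ primorial p j →
           APComb (λ q → q ℤd.∣ + primorial p j) (2 ^ (j ∸ 1)) (λ x → x ∈ A v))
        -- |#{x ∈ A v : d ∣ x} - |A v| / d| ≤ 2^(j-1), cleared of the denominator d
      × (∀ v → v ∣ primorial p j → (d : ℕ) → Coprime d (primorial p j) →
           ∣ + length (filter (λ x → d ∣? ∣ x ∣) (A v)) ℤ.* + d ℤ.- + length (A v) ∣
             ≤ 2 ^ (j ∸ 1) * d)
lemma3p5 j 1≤j p p-prime p-increasing p₁≡2 a L (divides t L≡t*2^j) 4^j≤L =
    A
  , (λ v _ → listing-unique a L (part v))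
  , (λ v _ x → A-⊆-interval)
  , (λ x → A-covers)
  , (λ x v w → A-disjoint)
  , (λ v → A-length)
  , (λ v v∣M x → A-coprime v∣M)
  , (λ v → A-APComb)
  , (λ v → A-discrepancy)
  where
  open Construction p j 1≤j p-prime p-increasing p₁≡2 a L t (trans L≡t*2^j (ℕP.*-comm t (2 ^ j))) 4^j≤L
  open Final
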